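{- Every primitive subset $A$ of a finite vector space $V$ over $\mathbb{F}_3$ is a maximal sum-free subset of $V$ and satisfies $|A|=\frac16\big(|V|+3|\mathrm{Sym}(A)|\big)$.
   Context: $\mathrm{Sym}(A)=\{x\in V: A+x=A\}$. A set is sum-free if there are no $x,y,z$ in it (not necessarily distinct) with $x+y=z$; maximal sum-free means sum-free and not properly contained in another sum-free subset of $V$. Affine notation: for an affine subspace $U$ of $V$, $[U]=U-U$, $\dim U=\dim[U]$; for affine subspaces $U\subseteq H$, $\dim(H/U)=\dim H-\dim U$; $C(U)$ is the linear span of $U$; a hyperplane is an affine subspace of codimension $1$; $\mathrm{aff}(X)$ is the affine hull of $X$. For affine subspaces $U\subseteq H$, a set $W\subseteq H$ is an $(H,U)$-half if $W+[U]=W$ and $H$ is the disjoint union of $U$, $W$ and $(-U)+(-W)$. Primitive sets (recursively on $\dim V$): $A\subseteq V$ is primitive if either (a) $A$ is a hyperplane of $V$ not containing $0$, or (b) there exist a hyperplane $H\subseteq V$ with $0\notin H$, a proper affine subspace $U\subsetneq H$, an $(H,U)$-half $W$, and a primitive subset $X$ of the vector space $C(U)$ such that (i) $A=W\cup X$, (ii) $X\cap[U]=\emptyset$, (iii) $\dim(H/U)\ge2$ or $X\ne -U$, (iv) $\mathrm{aff}(X\cap(-U))=-U$. -}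

module Defs where

open import Data.Nat using (ℕ; zero; suc; _+_; _*_; _≤_; _^_)
open import Data.Bool using (Bool; true; false; T; _∧_; _∨_; not)
open import Data.Vec using (Vec; []; _∷_; zipWith; replicate)
import Data.Vec as Vec
open import Data.List using (List; []; _∷_; concatMap)
import Data.List as List
open import Data.List.Relation.Unary.All using (All)
open import Data.Product using (Σ; Σ-syntax; ∃; _×_; _,_; proj₁; proj₂)
open import Data.Sum using (_⊎_)
open import Relation.Nullary using (¬_)
open import Relation.Binary.PropositionalEquality using (_≡_)

data F3 : Set where
  f0 f1 f2 : F3

infixl 6 _+₃_
infixl 7 _*₃_

_+₃_ : F3 → F3 → F3
f0 +₃ y  = y
f1 +₃ f0 = f1
f1 +₃ f1 = f2
f1 +₃ f2 = f0
f2 +₃ f0 = f2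
f2 +₃ f1 = f0
f2 +₃ f2 = f1

-₃_ : F3 → F3
-₃ f0 = f0
-₃ f1 = f2
-₃ f2 = f1

_*₃_ : F3 → F3 → F3
f0 *₃ y = f0
f1 *₃ y = y
f2 *₃ y = -₃ y

allF3 : List F3
allF3 = f0 ∷ f1 ∷ f2 ∷ []

-- The vector space V = F₃ⁿ (every finite F₃-vector space is one of these)

V : ℕ → Set
V n = Vec F3 n

infixl 6 _⊕_ _⊝_
infixr 7 _·_

_⊕_ : ∀ {n} → V n → V n → V n
_⊕_ = zipWith _+₃_

⊖_ : ∀ {n} → V n → V n
⊖_ = Vec.map -₃_

_⊝_ : ∀ {n} → V n → V n → V n
x ⊝ y = x ⊕ (⊖ y)

_·_ : ∀ {n} → F3 → V n → V n
c · x = Vec.map (c *₃_) x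

𝟎 : ∀ {n} → V n
𝟎 = replicate _ f0

allV : (n : ℕ) → List (V n)
allV zero    = [] ∷ []
allV (suc n) = concatMap (λ a → List.map (a ∷_) (allV n)) allF3

Subset : ℕ → Set
Subset n = V n → Bool

_⊆_ : ∀ {n} → Subset n → Subset n → Set
S ⊆ R = ∀ x → T (S x) → T (R x)

infix 2 _iff_
_iff_ : Set → Set → Set
P iff Q = (P → Q) × (Q → P)

countB : ∀ {a} {A : Set a} → (A → Bool) → List A → ℕ
countB p []       = 0
countB p (x ∷ xs) with p x
... | true  = suc (countB p xs)
... | false = countB p xs

allB : ∀ {a} {A : Set a} → (A → Bool) → List A → Bool
allB p []       = true
allB p (x ∷ xs) = p x ∧ allB p xs

_==ᵇ_ : Bool → Bool → Bool
true  ==ᵇ b = b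
false ==ᵇ b = not b

card : ∀ {n} → Subset n → ℕ
card {n} S = countB S (allV n)

-- Sym(A) = {x : A + x = A}, i.e. x such that ∀ y, (y ∈ A + x ⇔ y ∈ A),
-- where y ∈ A + x iff y - x ∈ A
Sym : ∀ {n} → Subset n → Subset n
Sym {n} A x = allB (λ y → A (y ⊝ x) ==ᵇ A y) (allV n)

SumFree : ∀ {n} → Subset n → Set
SumFree A = ∀ x y → T (A x) → T (A y) → ¬ T (A (x ⊕ y))

MaximalSumFree : ∀ {n} → Subset n → Set
MaximalSumFree {n} A =
  SumFree A × (∀ (B : Subset n) → SumFree B → A ⊆ B → B ⊆ A)

lincomb : ∀ {n d} → Vec F3 d → Vec (V n) d → V n
lincomb []       []       = 𝟎
lincomb (c ∷ cs) (v ∷ vs) = c · v ⊕ lincomb cs vs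

LinIndep : ∀ {n d} → Vec (V n) d → Set
LinIndep {d = d} b = ∀ (c : Vec F3 d) → lincomb c b ≡ 𝟎 → c ≡ replicate d f0

HasDim : ∀ {n} → (V n → Set) → ℕ → Set
HasDim {n} S d =
  Σ (Vec (V n) d) λ b → LinIndep b × (∀ x → S x iff (Σ (Vec F3 d) λ c → x ≡ lincomb c b))

IsSubspace : ∀ {n} → Subset n → Set
IsSubspace {n} L =
  T (L 𝟎) × (∀ (x y : V n) → T (L x) → T (L y) → T (L (x ⊕ y)))
          × (∀ (c : F3) (x : V n) → T (L x) → T (L (c · x)))

IsAffine : ∀ {n} → Subset n → Set
IsAffine {n} U =
  Σ (V n) λ p → Σ (Subset n) λ L → IsSubspace L × (∀ x → T (U x) iff T (L (x ⊝ p)))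

Diff : ∀ {n} → Subset n → V n → Set
Diff {n} U x = Σ (V n) λ a → Σ (V n) λ b → T (U a) × T (U b) × x ≡ a ⊝ b

AffDim : ∀ {n} → Subset n → ℕ → Set
AffDim U d = HasDim (Diff U) d

Neg : ∀ {n} → Subset n → V n → Set
Neg U x = T (U (⊖ x))

NegSum : ∀ {n} → Subset n → Subset n → V n → Set
NegSum {n} U W x = Σ (V n) λ u → Σ (V n) λ w → T (U u) × T (W w) × x ≡ (⊖ u) ⊕ (⊖ w)

sumL : ∀ {n} → List (F3 × V n) → V n
sumL []             = 𝟎
sumL ((c , v) ∷ cs) = c · v ⊕ sumL cs

sumC : ∀ {n} → List (F3 × V n) → F3
sumC []             = f0
sumC ((c , v) ∷ cs) = c +₃ sumC cs

InSpan : ∀ {n} → (V n → Set) → V n → Set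
InSpan {n} S x = Σ (List (F3 × V n)) λ cs → All (λ p → S (proj₂ p)) cs × x ≡ sumL cs

InAff : ∀ {n} → (V n → Set) → V n → Set
InAff {n} S x =
  Σ (List (F3 × V n)) λ cs → All (λ p → S (proj₂ p)) cs × sumC cs ≡ f1 × x ≡ sumL cs

IsHyperplaneIn : ∀ {n} → Subset n → Subset n → Set
IsHyperplaneIn L H =
  IsAffine H × H ⊆ L × Σ ℕ λ d → AffDim H d × HasDim (λ x → T (L x)) (suc d)

IsHalf : ∀ {n} → Subset n → Subset n → Subset n → Set
IsHalf {n} H U W =
  (∀ x → (Σ (V n) λ w → Σ (V n) λ u → T (W w) × Diff U u × x ≡ w ⊕ u) iff T (W x))
  × (∀ x → T (H x) iff (T (U x) ⊎ T (W x) ⊎ NegSum U W x))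
  × (∀ x → T (U x) → T (W x) → Data.Empty.⊥)
  × (∀ x → T (U x) → NegSum U W x → Data.Empty.⊥)
  × (∀ x → T (W x) → NegSum U W x → Data.Empty.⊥)
  where import Data.Empty

-- The inductive definition agrees with
-- the paper's recursion on dim, since dim C(U) < dim L.

data Primitive {n : ℕ} : Subset n → Subset n → Set where
  hyperplane : ∀ {L A} →
    IsHyperplaneIn L A → ¬ T (A 𝟎) → Primitive L A
  compose : ∀ {L A} (H U W X CU : Subset n) →
    IsHyperplaneIn L H → ¬ T (H 𝟎) →
    IsAffine U → U ⊆ H → (Σ (V n) λ h → T (H h) × ¬ T (U h)) →
    IsHalf H U W →
    (∀ x → T (CU x) iff InSpan (λ y → T (U y)) x) →
    Primitive CU X →
    (∀ x → A x ≡ (W x ∨ X x)) →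
    (∀ x → T (X x) → ¬ Diff U x) →
    ((Σ ℕ λ dH → Σ ℕ λ dU → AffDim H dH × AffDim U dU × dU + 2 ≤ dH)
      ⊎ ¬ (∀ x → T (X x) iff Neg U x)) →
    (∀ x → InAff (λ y → T (X y) × Neg U y) x iff Neg U x) →
    Primitive L A

full : ∀ {n} → Subset n
full _ = true

-- A hyperplane A ∌ 0 of L splits L into the three
-- cosets [A], A, −A of [A]; this gives sum-freeness and maximality at once, |L| = 3|A| and Sym(A) = [A].
-- For A = W ∪ X one has A ⊆ H ∪ −H with A ∩ H ⊆ W ∪ (X ∩ U) and A ∩ −H ⊆ X ∩ −U, and sum-freeness
-- follows case by case from that of X.  An element x ∈ L ∖ A completes a sum together with the point
-- b ∈ X ∩ −U provided by (iv), with a point of W, or inside X ∪ {x} by maximality of X in C(U); the only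
-- remaining case, x ∈ [H] ∖ [U] with X ∩ U = ∅, forces X = −U, hence dim(H/U) ≥ 2 by (iii), and then a
-- vector s ∈ [H] with s − x, s, s + x ∉ [U] yields two points of W differing by x.  For the count,
-- |H| = |U| + 2|W|, |C(U)| = 3|U| and |L| = 3|H|; every period of A or of X moves b inside −U, so it lies
-- in [U], under which W is invariant, whence Sym(A) = Sym(X) and the identity for X gives that for A.

module Submission where

open import Defs
open import Data.Nat using (ℕ; zero; suc; _+_; _*_; _^_; _<_; _≤_; s≤s)
open import Data.Nat.Properties using (+-assoc; +-comm; *-distribʳ-+; m≤n⇒m≤1+n; n<1+n)
open import Data.Nat.Tactic.RingSolver using (solve-∀)
open import Data.Bool using (Bool; true; false; T; _∧_; _∨_)
open import Data.Bool.Properties using (T-∧; T-∨)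
open import Data.Fin using (Fin; zero; suc)
open import Data.Vec using (Vec; []; _∷_; replicate; lookup)
import Data.Vec as Vec
open import Data.Vec.Properties using (lookup-map)
open import Data.Vec.Relation.Unary.All as Allᵥ using ([]; _∷_) renaming (All to Allᵥ)
open import Data.Vec.Relation.Binary.Pointwise.Inductive using (Pointwise; []; _∷_)
open import Data.List using ([]; _∷_; _++_)
import Data.List as List
open import Data.List.Membership.Propositional using (_∈_; lose)
open import Data.List.Membership.Propositional.Properties using (∈-++⁺ˡ; ∈-++⁺ʳ; ∈-map⁺)
open import Data.List.Relation.Unary.Any using (here; any?; satisfied)
open import Data.List.Relation.Unary.All as All using (All; []; _∷_)
open import Data.Product using (Σ; ∃; _×_; _,_; proj₁; proj₂)
open import Data.Sum using (_⊎_; inj₁; inj₂; [_,_]′)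
open import Data.Empty using (⊥; ⊥-elim)
open import Data.Unit using (tt)
open import Function.Base using (_∘_; id)
open import Function.Bundles using (Equivalence)
open import Relation.Nullary using (¬_; yes; no)
open import Relation.Nullary.Decidable using (T?)
open import Relation.Binary.PropositionalEquality

infixl 6 _+ˢ_ _⊕ᵗ_ _⊝ᵗ_
infixl 7 _*ˢ_
infixr 7 _·ᵗ_

data Scalar (j : ℕ) : Set where
  var      : Fin j → Scalar j
  con      : F3 → Scalar j
  _+ˢ_ _*ˢ_ : Scalar j → Scalar j → Scalar j
  -ˢ_      : Scalar j → Scalar j

data Term (k j : ℕ) : Set where
  var  : Fin k → Term k j
  _⊕ᵗ_ : Term k j → Term k j → Term k j
  ⊖ᵗ_  : Term k j → Term k j
  _·ᵗ_ : Scalar j → Term k j → Term k j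
  𝟎ᵗ   : Term k j

_⊝ᵗ_ : ∀ {k j} → Term k j → Term k j → Term k j
a ⊝ᵗ b = a ⊕ᵗ ⊖ᵗ b

⟦_⟧ˢ : ∀ {j} → Scalar j → Vec F3 j → F3
⟦ var i ⟧ˢ  τ = lookup τ i
⟦ con c ⟧ˢ  τ = c
⟦ a +ˢ b ⟧ˢ τ = ⟦ a ⟧ˢ τ +₃ ⟦ b ⟧ˢ τ
⟦ a *ˢ b ⟧ˢ τ = ⟦ a ⟧ˢ τ *₃ ⟦ b ⟧ˢ τ
⟦ -ˢ a ⟧ˢ   τ = -₃ ⟦ a ⟧ˢ τ

⟦_⟧ : ∀ {n k j} → Term k j → Vec (V n) k → Vec F3 j → V n
⟦ var i ⟧  ρ τ = lookup ρ i
⟦ a ⊕ᵗ b ⟧ ρ τ = ⟦ a ⟧ ρ τ ⊕ ⟦ b ⟧ ρ τ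
⟦ ⊖ᵗ a ⟧   ρ τ = ⊖ ⟦ a ⟧ ρ τ
⟦ c ·ᵗ a ⟧ ρ τ = ⟦ c ⟧ˢ τ · ⟦ a ⟧ ρ τ
⟦ 𝟎ᵗ ⟧     ρ τ = 𝟎

⟦_⟧₁ : ∀ {k j} → Term k j → Vec F3 k → Vec F3 j → F3
⟦ var i ⟧₁  σ τ = lookup σ i
⟦ a ⊕ᵗ b ⟧₁ σ τ = ⟦ a ⟧₁ σ τ +₃ ⟦ b ⟧₁ σ τ
⟦ ⊖ᵗ a ⟧₁   σ τ = -₃ ⟦ a ⟧₁ σ τ
⟦ c ·ᵗ a ⟧₁ σ τ = ⟦ c ⟧ˢ τ *₃ ⟦ a ⟧₁ σ τ
⟦ 𝟎ᵗ ⟧₁     σ τ = f0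

⟦⟧-coordinates : ∀ {n k j} (e : Term k j) (ρ : Vec (V (suc n)) k) τ →
  ⟦ e ⟧ ρ τ ≡ ⟦ e ⟧₁ (Vec.map Vec.head ρ) τ ∷ ⟦ e ⟧ (Vec.map Vec.tail ρ) τ
⟦⟧-coordinates (var i) ρ τ
  rewrite lookup-map i Vec.head ρ | lookup-map i Vec.tail ρ with lookup ρ i
... | x ∷ xs = refl
⟦⟧-coordinates (a ⊕ᵗ b) ρ τ rewrite ⟦⟧-coordinates a ρ τ | ⟦⟧-coordinates b ρ τ = refl
⟦⟧-coordinates (⊖ᵗ a)   ρ τ rewrite ⟦⟧-coordinates a ρ τ = refl
⟦⟧-coordinates (c ·ᵗ a) ρ τ rewrite ⟦⟧-coordinates a ρ τ = refl
⟦⟧-coordinates 𝟎ᵗ       ρ τ = refl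

allValuations : ∀ k → (Vec F3 k → Bool) → Bool
allValuations zero    p = p []
allValuations (suc k) p =
  allValuations k (λ σ → p (f0 ∷ σ)) ∧ allValuations k (λ σ → p (f1 ∷ σ)) ∧ allValuations k (λ σ → p (f2 ∷ σ))

allValuations-sound : ∀ k p → T (allValuations k p) → ∀ σ → T (p σ)
allValuations-sound zero p t [] = t
allValuations-sound (suc k) p t (c ∷ σ) with Equivalence.to (T-∧ {allValuations k (λ σ → p (f0 ∷ σ))}) t
... | t₀ , t₁₂ with Equivalence.to (T-∧ {allValuations k (λ σ → p (f1 ∷ σ))}) t₁₂
...   | t₁ , t₂ with c
...     | f0 = allValuations-sound k _ t₀ σ
...     | f1 = allValuations-sound k _ t₁ σ
...     | f2 = allValuations-sound k _ t₂ σ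

_≟₃_ : F3 → F3 → Bool
f0 ≟₃ f0 = true
f1 ≟₃ f1 = true
f2 ≟₃ f2 = true
_  ≟₃ _  = false

≟₃-sound : ∀ a b → T (a ≟₃ b) → a ≡ b
≟₃-sound f0 f0 _ = refl
≟₃-sound f1 f1 _ = refl
≟₃-sound f2 f2 _ = refl

Holds : ∀ {k j} → Term k j → Term k j → Set
Holds {k} {j} a b = T (allValuations j λ τ → allValuations k λ σ → ⟦ a ⟧₁ σ τ ≟₃ ⟦ b ⟧₁ σ τ)

-- An identity of F₃ⁿ holds coordinatewise, so it suffices to check it on F₃ by enumeration.
solve : ∀ {k j} (a b : Term k j) → Holds a b → ∀ {n} (ρ : Vec (V n) k) τ → ⟦ a ⟧ ρ τ ≡ ⟦ b ⟧ ρ τ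
solve {k} {j} a b holds ρ τ = coordinatewise ρ
  where
  pointwise : ∀ σ → ⟦ a ⟧₁ σ τ ≡ ⟦ b ⟧₁ σ τ
  pointwise σ = ≟₃-sound _ _ (allValuations-sound k _ (allValuations-sound j _ holds τ) σ)
  coordinatewise : ∀ {n} (ρ : Vec (V n) k) → ⟦ a ⟧ ρ τ ≡ ⟦ b ⟧ ρ τ
  coordinatewise {zero} ρ with ⟦ a ⟧ ρ τ | ⟦ b ⟧ ρ τ
  ... | [] | [] = refl
  coordinatewise {suc n} ρ rewrite ⟦⟧-coordinates a ρ τ | ⟦⟧-coordinates b ρ τ =
    cong₂ _∷_ (pointwise (Vec.map Vec.head ρ)) (coordinatewise (Vec.map Vec.tail ρ))

v₀ : ∀ {k j} → Term (suc k) j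
v₀ = var zero
v₁ : ∀ {k j} → Term (suc (suc k)) j
v₁ = var (suc zero)
v₂ : ∀ {k j} → Term (suc (suc (suc k))) j
v₂ = var (suc (suc zero))
v₃ : ∀ {k j} → Term (suc (suc (suc (suc k)))) j
v₃ = var (suc (suc (suc zero)))
σ₀ : ∀ {j} → Scalar (suc j)
σ₀ = var zero
σ₁ : ∀ {j} → Scalar (suc (suc j))
σ₁ = var (suc zero)
σ₂ : ∀ {j} → Scalar (suc (suc (suc j)))
σ₂ = var (suc (suc zero))

T-ext : ∀ {a b} → (T a → T b) → (T b → T a) → a ≡ b
T-ext {false} {false} _ _ = refl
T-ext {false} {true}  _ g = ⊥-elim (g tt)
T-ext {true}  {false} f _ = ⊥-elim (f tt)
T-ext {true}  {true}  _ _ = refl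

∨-introˡ : ∀ {a b} → T a → T (a ∨ b)
∨-introˡ = Equivalence.from T-∨ ∘ inj₁

∨-introʳ : ∀ {a b} → T b → T (a ∨ b)
∨-introʳ = Equivalence.from T-∨ ∘ inj₂

∨-elim : ∀ {a b} → T (a ∨ b) → T a ⊎ T b
∨-elim = Equivalence.to T-∨

==ᵇ-sound : ∀ {a b} → T (a ==ᵇ b) → a ≡ b
==ᵇ-sound {true}  {true}  _ = refl
==ᵇ-sound {false} {false} _ = refl

==ᵇ-refl : ∀ a → T (a ==ᵇ a)
==ᵇ-refl true  = tt
==ᵇ-refl false = tt

∨-cancelˡ : ∀ {a b a′ b′} → a ∨ b ≡ a′ ∨ b′ → a ≡ a′ → (T a → ¬ T b) → (T a′ → ¬ T b′) → b ≡ b′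
∨-cancelˡ {false}           eq refl _  _  = eq
∨-cancelˡ {true} {true}     _  refl ab _  = ⊥-elim (ab tt tt)
∨-cancelˡ {true} {false} {b′ = true}  _ refl _ ab′ = ⊥-elim (ab′ tt tt)
∨-cancelˡ {true} {false} {b′ = false} _ refl _ _   = refl

indicator : Bool → ℕ
indicator true  = 1
indicator false = 0

indicator-∨ : ∀ a b → (T a → T b → ⊥) → indicator (a ∨ b) ≡ indicator a + indicator b
indicator-∨ true  true  h = ⊥-elim (h tt tt)
indicator-∨ true  false h = refl
indicator-∨ false b     h = refl

countB-∷ : ∀ {A : Set} (p : A → Bool) x xs → countB p (x ∷ xs) ≡ indicator (p x) + countB p xs
countB-∷ p x xs with p x
... | true  = refl
... | false = refl

countB-++ : ∀ {A : Set} (p : A → Bool) xs ys → countB p (xs ++ ys) ≡ countB p xs + countB p ys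
countB-++ p []       ys = refl
countB-++ p (x ∷ xs) ys
  rewrite countB-∷ p x (xs ++ ys) | countB-∷ p x xs | countB-++ p xs ys =
  sym (+-assoc (indicator (p x)) _ _)

countB-map : ∀ {A B : Set} (p : B → Bool) (f : A → B) xs → countB p (List.map f xs) ≡ countB (p ∘ f) xs
countB-map p f []       = refl
countB-map p f (x ∷ xs)
  rewrite countB-∷ p (f x) (List.map f xs) | countB-∷ (p ∘ f) x xs | countB-map p f xs = refl

countB-cong : ∀ {A : Set} {p q : A → Bool} → (∀ x → p x ≡ q x) → ∀ xs → countB p xs ≡ countB q xs
countB-cong h []       = refl
countB-cong {p = p} {q} h (x ∷ xs)
  rewrite countB-∷ p x xs | countB-∷ q x xs | h x | countB-cong h xs = refl

countB-∨ : ∀ {A : Set} (p q : A → Bool) → (∀ x → T (p x) → T (q x) → ⊥) → ∀ xs →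
           countB (λ x → p x ∨ q x) xs ≡ countB p xs + countB q xs
countB-∨ p q disjoint []       = refl
countB-∨ p q disjoint (x ∷ xs)
  rewrite countB-∷ (λ x → p x ∨ q x) x xs | countB-∷ p x xs | countB-∷ q x xs
        | countB-∨ p q disjoint xs | indicator-∨ (p x) (q x) (disjoint x) =
  interchange (indicator (p x)) (indicator (q x)) (countB p xs) (countB q xs)
  where
  interchange : ∀ a b c d → a + b + (c + d) ≡ a + c + (b + d)
  interchange = solve-∀

sum₃ : (F3 → ℕ) → ℕ
sum₃ f = f f0 + (f f1 + (f f2 + 0))

sum₃-cong : ∀ {f g : F3 → ℕ} → (∀ a → f a ≡ g a) → sum₃ f ≡ sum₃ g
sum₃-cong h rewrite h f0 | h f1 | h f2 = refl

sum₃-translate : ∀ t (f : F3 → ℕ) → sum₃ (λ a → f (a +₃ t)) ≡ sum₃ f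
sum₃-translate f0 f = refl
sum₃-translate f1 f = rotate (f f0) (f f1) (f f2)
  where rotate : ∀ a b c → b + (c + (a + 0)) ≡ a + (b + (c + 0))
        rotate = solve-∀
sum₃-translate f2 f = rotate (f f0) (f f1) (f f2)
  where rotate : ∀ a b c → c + (a + (b + 0)) ≡ a + (b + (c + 0))
        rotate = solve-∀

sum₃-negate : ∀ (f : F3 → ℕ) → sum₃ (λ a → f (-₃ a)) ≡ sum₃ f
sum₃-negate f = swap (f f0) (f f1) (f f2)
  where swap : ∀ a b c → a + (c + (b + 0)) ≡ a + (b + (c + 0))
        swap = solve-∀

card-∷ : ∀ {n} (P : Subset (suc n)) → card P ≡ sum₃ (λ a → card (λ x → P (a ∷ x)))
card-∷ {n} P
  rewrite countB-++ P (List.map (f0 ∷_) (allV n)) (List.map (f1 ∷_) (allV n) ++ (List.map (f2 ∷_) (allV n) ++ []))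
        | countB-++ P (List.map (f1 ∷_) (allV n)) (List.map (f2 ∷_) (allV n) ++ [])
        | countB-++ P (List.map (f2 ∷_) (allV n)) []
        | countB-map P (f0 ∷_) (allV n) | countB-map P (f1 ∷_) (allV n) | countB-map P (f2 ∷_) (allV n) = refl

card-cong : ∀ {n} {P Q : Subset n} → (∀ x → P x ≡ Q x) → card P ≡ card Q
card-cong {n} h = countB-cong h (allV n)

card-translate : ∀ {n} (P : Subset n) t → card (λ x → P (x ⊕ t)) ≡ card P
card-translate {zero}  P [] = card-cong {P = λ x → P (x ⊕ [])} {P} λ { [] → refl }
card-translate {suc n} P (t₀ ∷ t) = begin
  card (λ x → P (x ⊕ (t₀ ∷ t)))                           ≡⟨ card-∷ (λ x → P (x ⊕ (t₀ ∷ t))) ⟩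
  sum₃ (λ a → card (λ x → P ((a +₃ t₀) ∷ (x ⊕ t))))      ≡⟨ sum₃-cong (λ a → card-translate (λ x → P ((a +₃ t₀) ∷ x)) t) ⟩
  sum₃ (λ a → card (λ x → P ((a +₃ t₀) ∷ x)))             ≡⟨ sum₃-translate t₀ (λ a → card (λ x → P (a ∷ x))) ⟩
  sum₃ (λ a → card (λ x → P (a ∷ x)))                     ≡⟨ card-∷ P ⟨
  card P                                                  ∎
  where open ≡-Reasoning

card-negate : ∀ {n} (P : Subset n) → card (λ x → P (⊖ x)) ≡ card P
card-negate {zero}  P = card-cong {P = λ x → P (⊖ x)} {P} λ { [] → refl }
card-negate {suc n} P = begin
  card (λ x → P (⊖ x))                           ≡⟨ card-∷ (λ x → P (⊖ x)) ⟩
  sum₃ (λ a → card (λ x → P (-₃ a ∷ ⊖ x)))      ≡⟨ sum₃-cong (λ a → card-negate (λ x → P (-₃ a ∷ x))) ⟩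
  sum₃ (λ a → card (λ x → P (-₃ a ∷ x)))        ≡⟨ sum₃-negate (λ a → card (λ x → P (a ∷ x))) ⟩
  sum₃ (λ a → card (λ x → P (a ∷ x)))            ≡⟨ card-∷ P ⟨
  card P                                         ∎
  where open ≡-Reasoning

card-full : ∀ n → card (full {n}) ≡ 3 ^ n
card-full zero    = refl
card-full (suc n) rewrite card-∷ (full {suc n}) | card-full n = solve-∀

allV-complete : ∀ n (x : V n) → x ∈ allV n
allV-complete zero    []       = here refl
allV-complete (suc n) (f0 ∷ x) = ∈-++⁺ˡ (∈-map⁺ (f0 ∷_) (allV-complete n x))
allV-complete (suc n) (f1 ∷ x) =
  ∈-++⁺ʳ (List.map (f0 ∷_) (allV n)) (∈-++⁺ˡ (∈-map⁺ (f1 ∷_) (allV-complete n x)))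
allV-complete (suc n) (f2 ∷ x) =
  ∈-++⁺ʳ (List.map (f0 ∷_) (allV n))
    (∈-++⁺ʳ (List.map (f1 ∷_) (allV n)) (∈-++⁺ˡ (∈-map⁺ (f2 ∷_) (allV-complete n x))))

search : ∀ {n} (P : Subset n) → (∃ λ x → T (P x)) ⊎ (∀ x → ¬ T (P x))
search {n} P with any? (T? ∘ P) (allV n)
... | yes found   = inj₁ (satisfied found)
... | no  missing = inj₂ λ x Px → missing (lose (allV-complete n x) Px)

allB⇒All : ∀ {A : Set} (p : A → Bool) xs → T (allB p xs) → All (T ∘ p) xs
allB⇒All p []       _ = []
allB⇒All p (x ∷ xs) t with Equivalence.to (T-∧ {p x}) t
... | px , rest = px ∷ allB⇒All p xs rest

All⇒allB : ∀ {A : Set} (p : A → Bool) xs → All (T ∘ p) xs → T (allB p xs)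
All⇒allB p []       []         = tt
All⇒allB p (x ∷ xs) (px ∷ pxs) = Equivalence.from T-∧ (px , All⇒allB p xs pxs)

Sym-sound : ∀ {n} (S : Subset n) t → T (Sym S t) → ∀ y → S (y ⊝ t) ≡ S y
Sym-sound {n} S t s y = ==ᵇ-sound (All.lookup (allB⇒All _ (allV n) s) (allV-complete n y))

Sym-complete : ∀ {n} (S : Subset n) t → (∀ y → S (y ⊝ t) ≡ S y) → T (Sym S t)
Sym-complete {n} S t h =
  All⇒allB _ (allV n) (All.tabulate λ {y} _ → subst (λ b → T (S (y ⊝ t) ==ᵇ b)) (h y) (==ᵇ-refl (S (y ⊝ t))))

Nontrivial : ∀ {k} → Vec F3 k → Set
Nontrivial {k} c = ¬ c ≡ replicate k f0

trivial-or-nontrivial : ∀ {k} (c : Vec F3 k) → c ≡ replicate k f0 ⊎ Nontrivial c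
trivial-or-nontrivial []       = inj₁ refl
trivial-or-nontrivial (f1 ∷ c) = inj₂ λ ()
trivial-or-nontrivial (f2 ∷ c) = inj₂ λ ()
trivial-or-nontrivial (f0 ∷ c) with trivial-or-nontrivial c
... | inj₁ c≡0 = inj₁ (cong (f0 ∷_) c≡0)
... | inj₂ c≢0 = inj₂ λ f0∷c≡0 → c≢0 (cong Vec.tail f0∷c≡0)

lincomb-zeroˡ : ∀ {n d} (b : Vec (V n) d) → lincomb (replicate d f0) b ≡ 𝟎
lincomb-zeroˡ []      = refl
lincomb-zeroˡ (v ∷ b) rewrite lincomb-zeroˡ b = solve (con f0 ·ᵗ v₀ ⊕ᵗ 𝟎ᵗ) 𝟎ᵗ tt (v ∷ []) []

lincomb-⊕ : ∀ {n d} (c c′ : Vec F3 d) (b : Vec (V n) d) → lincomb (c ⊕ c′) b ≡ lincomb c b ⊕ lincomb c′ b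
lincomb-⊕ [] [] [] = solve 𝟎ᵗ (𝟎ᵗ ⊕ᵗ 𝟎ᵗ) tt [] []
lincomb-⊕ (a ∷ c) (a′ ∷ c′) (v ∷ b) rewrite lincomb-⊕ c c′ b =
  solve ((σ₀ +ˢ σ₁) ·ᵗ v₀ ⊕ᵗ (v₁ ⊕ᵗ v₂)) ((σ₀ ·ᵗ v₀ ⊕ᵗ v₁) ⊕ᵗ (σ₁ ·ᵗ v₀ ⊕ᵗ v₂)) tt
    (v ∷ lincomb c b ∷ lincomb c′ b ∷ []) (a ∷ a′ ∷ [])

lincomb-· : ∀ {n d} (a : F3) (c : Vec F3 d) (b : Vec (V n) d) → lincomb (a · c) b ≡ a · lincomb c b
lincomb-· a [] [] = solve 𝟎ᵗ (σ₀ ·ᵗ 𝟎ᵗ) tt [] (a ∷ [])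
lincomb-· a (a′ ∷ c) (v ∷ b) rewrite lincomb-· a c b =
  solve ((σ₀ *ˢ σ₁) ·ᵗ v₀ ⊕ᵗ σ₀ ·ᵗ v₁) (σ₀ ·ᵗ (σ₁ ·ᵗ v₀ ⊕ᵗ v₁)) tt (v ∷ lincomb c b ∷ []) (a ∷ a′ ∷ [])

-- Pointwise (HasCoordinates e) f M: row i of M holds the coordinates of fᵢ with respect to e.
HasCoordinates : ∀ {n m} → Vec (V n) m → V n → V m → Set
HasCoordinates e v μ = v ≡ lincomb μ e

lincomb-coordinates : ∀ {n m k} {e : Vec (V n) m} {f : Vec (V n) k} {M : Vec (V m) k} →
  Pointwise (HasCoordinates e) f M → ∀ c → lincomb c f ≡ lincomb (lincomb c M) e
lincomb-coordinates {e = e} [] [] = sym (lincomb-zeroˡ e)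
lincomb-coordinates {e = e} {v ∷ f} {μ ∷ M} (refl ∷ f∼M) (a ∷ c) = begin
  a · lincomb μ e ⊕ lincomb c f                  ≡⟨ cong (a · lincomb μ e ⊕_) (lincomb-coordinates f∼M c) ⟩
  a · lincomb μ e ⊕ lincomb (lincomb c M) e      ≡⟨ cong (_⊕ lincomb (lincomb c M) e) (lincomb-· a μ e) ⟨
  lincomb (a · μ) e ⊕ lincomb (lincomb c M) e    ≡⟨ lincomb-⊕ (a · μ) (lincomb c M) e ⟨
  lincomb (a · μ ⊕ lincomb c M) e                ∎
  where open ≡-Reasoning

*₃-zeroʳ-+ : ∀ a → a *₃ f0 +₃ f0 ≡ f0
*₃-zeroʳ-+ f0 = refl
*₃-zeroʳ-+ f1 = refl
*₃-zeroʳ-+ f2 = refl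

HeadsZero : ∀ {m k} → Vec (V (suc m)) k → Set
HeadsZero = Allᵥ (λ r → Vec.head r ≡ f0)

lincomb-headsZero : ∀ {m k} {R : Vec (V (suc m)) k} → HeadsZero R →
                    ∀ c → lincomb c R ≡ f0 ∷ lincomb c (Vec.map Vec.tail R)
lincomb-headsZero [] [] = refl
lincomb-headsZero {R = (_ ∷ r) ∷ R} (refl ∷ hz) (a ∷ c) rewrite lincomb-headsZero hz c =
  cong (_∷ lincomb (a ∷ c) (Vec.map Vec.tail ((f0 ∷ r) ∷ R))) (*₃-zeroʳ-+ a)

-- One step of Gaussian elimination: a nontrivial combination of k reduced rows lifts to one of R.
record Reduction {m k} (R : Vec (V (suc m)) (suc k)) : Set where
  field
    rows            : Vec (V m) k
    lift            : Vec F3 k → Vec F3 (suc k)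
    lift-nontrivial : ∀ c → Nontrivial c → Nontrivial (lift c)
    lincomb-lift    : ∀ c → lincomb (lift c) R ≡ f0 ∷ lincomb c rows

pivot-clears : ∀ {a} → ¬ a ≡ f0 → ∀ s → s +₃ -₃ ((s *₃ a) *₃ a) ≡ f0
pivot-clears {f0} a≢0 _  = ⊥-elim (a≢0 refl)
pivot-clears {f1} _   f0 = refl
pivot-clears {f1} _   f1 = refl
pivot-clears {f1} _   f2 = refl
pivot-clears {f2} _   f0 = refl
pivot-clears {f2} _   f1 = refl
pivot-clears {f2} _   f2 = refl

-- Clearing the first coordinate with a row whose head a is nonzero; a⁻¹ = a in F₃.
module Pivot {m} (a : F3) (a≢0 : ¬ a ≡ f0) (tail : V m) where

  pivot : V (suc m)
  pivot = a ∷ tail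

  weight : V (suc m) → F3
  weight s = Vec.head s *₃ a

  reduce : V (suc m) → V m
  reduce s = Vec.tail (s ⊝ weight s · pivot)

  split : ∀ s → s ≡ weight s · pivot ⊕ (f0 ∷ reduce s)
  split s@(s₀ ∷ _) =
    trans (solve v₀ (σ₀ ·ᵗ v₁ ⊕ᵗ (v₀ ⊝ᵗ σ₀ ·ᵗ v₁)) tt (s ∷ pivot ∷ []) (weight s ∷ []))
          (cong (λ z → weight s · pivot ⊕ z) (cong (_∷ reduce s) (pivot-clears a≢0 s₀)))

  weightOf : ∀ {k} → Vec F3 k → Vec (V (suc m)) k → F3
  weightOf []      []      = f0
  weightOf (c₀ ∷ c) (s ∷ S) = c₀ *₃ weight s +₃ weightOf c S

  lincomb-split : ∀ {k} (c : Vec F3 k) S →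
                  lincomb c S ≡ weightOf c S · pivot ⊕ (f0 ∷ lincomb c (Vec.map reduce S))
  lincomb-split []       []      = solve 𝟎ᵗ (con f0 ·ᵗ v₀ ⊕ᵗ 𝟎ᵗ) tt (pivot ∷ []) []
  lincomb-split (c₀ ∷ c) (s ∷ S) = begin
    c₀ · s ⊕ lincomb c S
      ≡⟨ cong₂ (λ u w → c₀ · u ⊕ w) (split s) (lincomb-split c S) ⟩
    c₀ · (weight s · pivot ⊕ (f0 ∷ reduce s)) ⊕ (weightOf c S · pivot ⊕ (f0 ∷ rest))
      ≡⟨ solve (σ₀ ·ᵗ (σ₁ ·ᵗ v₀ ⊕ᵗ v₁) ⊕ᵗ (σ₂ ·ᵗ v₀ ⊕ᵗ v₂)) ((σ₀ *ˢ σ₁ +ˢ σ₂) ·ᵗ v₀ ⊕ᵗ (σ₀ ·ᵗ v₁ ⊕ᵗ v₂)) tt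
           (pivot ∷ (f0 ∷ reduce s) ∷ (f0 ∷ rest) ∷ []) (c₀ ∷ weight s ∷ weightOf c S ∷ []) ⟩
    (c₀ *₃ weight s +₃ weightOf c S) · pivot ⊕ (c₀ · (f0 ∷ reduce s) ⊕ (f0 ∷ rest))
      ≡⟨ cong (λ h → (c₀ *₃ weight s +₃ weightOf c S) · pivot ⊕ (h ∷ c₀ · reduce s ⊕ rest)) (*₃-zeroʳ-+ c₀) ⟩
    (c₀ *₃ weight s +₃ weightOf c S) · pivot ⊕ (f0 ∷ c₀ · reduce s ⊕ rest)
      ∎
    where
    open ≡-Reasoning
    rest : V m
    rest = lincomb c (Vec.map reduce S)

  reduction : ∀ {k} (S : Vec (V (suc m)) k) → Reduction (pivot ∷ S)
  reduction S = record
    { rows            = Vec.map reduce S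
    ; lift            = λ c → -₃ weightOf c S ∷ c
    ; lift-nontrivial = λ c c≢0 lift≡0 → c≢0 (cong Vec.tail lift≡0)
    ; lincomb-lift    = λ c →
        trans (cong (-₃ weightOf c S · pivot ⊕_) (lincomb-split c S))
              (solve ((-ˢ σ₀) ·ᵗ v₀ ⊕ᵗ (σ₀ ·ᵗ v₀ ⊕ᵗ v₁)) v₁ tt
                     (pivot ∷ (f0 ∷ lincomb c (Vec.map reduce S)) ∷ []) (weightOf c S ∷ []))
    }

reduction-under-zero-head : ∀ {m k} {S : Vec (V (suc m)) (suc k)} (t : V m) →
                            Reduction S → Reduction ((f0 ∷ t) ∷ S)
reduction-under-zero-head {S = S} t red = record
  { rows            = t ∷ rows
  ; lift            = lift′
  ; lift-nontrivial = nontrivial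
  ; lincomb-lift    = lincomb-lift′
  }
  where
  open Reduction red
  lift′ : Vec F3 _ → Vec F3 _
  lift′ c = Vec.head c ∷ lift (Vec.tail c)
  nontrivial : ∀ c → Nontrivial c → Nontrivial (lift′ c)
  nontrivial (c₀ ∷ c) c≢0 lift≡0 with trivial-or-nontrivial c
  ... | inj₁ c≡0  = c≢0 (cong₂ _∷_ (cong Vec.head lift≡0) c≡0)
  ... | inj₂ c≢0′ = lift-nontrivial c c≢0′ (cong Vec.tail lift≡0)
  lincomb-lift′ : ∀ c → lincomb (lift′ c) ((f0 ∷ t) ∷ S) ≡ f0 ∷ lincomb c (t ∷ rows)
  lincomb-lift′ (c₀ ∷ c) rewrite lincomb-lift c = cong (_∷ c₀ · t ⊕ lincomb c rows) (*₃-zeroʳ-+ c₀)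

reduction-or-headsZero : ∀ {m k} (R : Vec (V (suc m)) (suc k)) → Reduction R ⊎ HeadsZero R
reduction-or-headsZero ((f1 ∷ t) ∷ S) = inj₁ (Pivot.reduction f1 (λ ()) t S)
reduction-or-headsZero ((f2 ∷ t) ∷ S) = inj₁ (Pivot.reduction f2 (λ ()) t S)
reduction-or-headsZero {k = zero}  ((f0 ∷ t) ∷ []) = inj₂ (refl ∷ [])
reduction-or-headsZero {k = suc k} ((f0 ∷ t) ∷ S) with reduction-or-headsZero S
... | inj₁ red = inj₁ (reduction-under-zero-head t red)
... | inj₂ hz  = inj₂ (refl ∷ hz)

linear-dependence : ∀ m {k} (R : Vec (V m) k) → m < k → ∃ λ c → Nontrivial c × lincomb c R ≡ 𝟎
linear-dependence zero    {suc k} R _ = (f1 ∷ replicate k f0) , (λ ()) , V0-trivial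
  where
  V0-trivial : ∀ {x y : V 0} → x ≡ y
  V0-trivial {[]} {[]} = refl
linear-dependence (suc m) {suc k} R (s≤s m<k) with reduction-or-headsZero R
... | inj₁ red =
  let open Reduction red
      c , c≢0 , Σc≡0 = linear-dependence m rows m<k
  in lift c , lift-nontrivial c c≢0 , trans (lincomb-lift c) (cong (f0 ∷_) Σc≡0)
... | inj₂ hz =
  let c , c≢0 , Σc≡0 = linear-dependence m (Vec.map Vec.tail R) (m≤n⇒m≤1+n m<k)
  in c , c≢0 , trans (lincomb-headsZero hz c) (cong (f0 ∷_) Σc≡0)

InSpanOf : ∀ {n m} → Vec (V n) m → V n → Set
InSpanOf e v = ∃ (HasCoordinates e v)

coordinate-matrix : ∀ {n m k} {e : Vec (V n) m} {f : Vec (V n) k} →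
                    Allᵥ (InSpanOf e) f → Σ (Vec (V m) k) (Pointwise (HasCoordinates e) f)
coordinate-matrix []                  = [] , []
coordinate-matrix ((μ , v≡μe) ∷ rest) with coordinate-matrix rest
... | M , f∼M = μ ∷ M , v≡μe ∷ f∼M

dependent-in-span : ∀ {n m k} (e : Vec (V n) m) {f : Vec (V n) k} → Allᵥ (InSpanOf e) f → m < k →
                    ∃ λ c → Nontrivial c × lincomb c f ≡ 𝟎
dependent-in-span {m = m} e {f} f⊆⟨e⟩ m<k with coordinate-matrix f⊆⟨e⟩
... | M , f∼M with linear-dependence m M m<k
... | c , c≢0 , Mc≡0 = c , c≢0 , (begin
  lincomb c f                ≡⟨ lincomb-coordinates f∼M c ⟩
  lincomb (lincomb c M) e    ≡⟨ cong (λ μ → lincomb μ e) Mc≡0 ⟩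
  lincomb (replicate m f0) e ≡⟨ lincomb-zeroˡ e ⟩
  𝟎                          ∎)
  where open ≡-Reasoning

members-of-span : ∀ {n k} (S : V n → Set) (b : Vec (V n) k) → (∀ c → S (lincomb c b)) → Allᵥ S b
members-of-span S []      h = []
members-of-span S (v ∷ b) h =
  subst S (trans (cong (f1 · v ⊕_) (lincomb-zeroˡ b)) (solve (con f1 ·ᵗ v₀ ⊕ᵗ 𝟎ᵗ) v₀ tt (v ∷ []) []))
        (h (f1 ∷ replicate _ f0))
  ∷ members-of-span S b (λ c → subst S (solve (con f0 ·ᵗ v₀ ⊕ᵗ v₁) v₁ tt (v ∷ lincomb c b ∷ []) []) (h (f0 ∷ c)))

basis-spans : ∀ {n d} {S : V n → Set} → (dim : HasDim S d) → Allᵥ S (proj₁ dim)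
basis-spans {S = S} (b , _ , S⇔span) = members-of-span S b λ c → proj₂ (S⇔span _) (c , refl)

HasDim-closed : ∀ {n d} {S : V n → Set} → HasDim S d → ∀ a b x y → S x → S y → S (a · x ⊕ b · y)
HasDim-closed {S = S} (e , _ , S⇔span) a b x y x∈ y∈
  with proj₁ (S⇔span x) x∈ | proj₁ (S⇔span y) y∈
... | μ , refl | ν , refl = proj₂ (S⇔span _) (a · μ ⊕ b · ν , (begin
  a · lincomb μ e ⊕ b · lincomb ν e             ≡⟨ cong₂ _⊕_ (lincomb-· a μ e) (lincomb-· b ν e) ⟨
  lincomb (a · μ) e ⊕ lincomb (b · ν) e         ≡⟨ lincomb-⊕ (a · μ) (b · ν) e ⟨
  lincomb (a · μ ⊕ b · ν) e                     ∎))
  where open ≡-Reasoning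

∈-resp : ∀ {n} (P : Subset n) {x y} → x ≡ y → T (P x) → T (P y)
∈-resp P = subst (λ z → T (P z))

module AffineSubspace {n} {U : Subset n} (affine : IsAffine U) where

  base : V n
  base = proj₁ affine

  Dir : Subset n
  Dir = proj₁ (proj₂ affine)

  Dir-𝟎 : T (Dir 𝟎)
  Dir-𝟎 = proj₁ (proj₁ (proj₂ (proj₂ affine)))

  Dir-⊕ : ∀ x y → T (Dir x) → T (Dir y) → T (Dir (x ⊕ y))
  Dir-⊕ = proj₁ (proj₂ (proj₁ (proj₂ (proj₂ affine))))

  Dir-· : ∀ c x → T (Dir x) → T (Dir (c · x))
  Dir-· = proj₂ (proj₂ (proj₁ (proj₂ (proj₂ affine))))

  ∈⇒Dir : ∀ x → T (U x) → T (Dir (x ⊝ base))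
  ∈⇒Dir x = proj₁ (proj₂ (proj₂ (proj₂ affine)) x)

  Dir⇒∈ : ∀ x → T (Dir (x ⊝ base)) → T (U x)
  Dir⇒∈ x = proj₂ (proj₂ (proj₂ (proj₂ affine)) x)

  Dir-⊖ : ∀ x → T (Dir x) → T (Dir (⊖ x))
  Dir-⊖ x x∈ = ∈-resp Dir (solve (con f2 ·ᵗ v₀) (⊖ᵗ v₀) tt (x ∷ []) []) (Dir-· f2 x x∈)

  Dir-⊝ : ∀ x y → T (Dir x) → T (Dir y) → T (Dir (x ⊝ y))
  Dir-⊝ x y x∈ y∈ = Dir-⊕ x (⊖ y) x∈ (Dir-⊖ y y∈)

  base∈ : T (U base)
  base∈ = Dir⇒∈ base (∈-resp Dir (solve 𝟎ᵗ (v₀ ⊝ᵗ v₀) tt (base ∷ []) []) Dir-𝟎)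

  ⊝∈Dir : ∀ x y → T (U x) → T (U y) → T (Dir (x ⊝ y))
  ⊝∈Dir x y x∈ y∈ =
    ∈-resp Dir (solve ((v₀ ⊝ᵗ v₂) ⊝ᵗ (v₁ ⊝ᵗ v₂)) (v₀ ⊝ᵗ v₁) tt (x ∷ y ∷ base ∷ []) [])
           (Dir-⊝ _ _ (∈⇒Dir x x∈) (∈⇒Dir y y∈))

  ⊕Dir∈ : ∀ x d → T (U x) → T (Dir d) → T (U (x ⊕ d))
  ⊕Dir∈ x d x∈ d∈ =
    Dir⇒∈ _ (∈-resp Dir (solve ((v₀ ⊝ᵗ v₂) ⊕ᵗ v₁) (v₀ ⊕ᵗ v₁ ⊝ᵗ v₂) tt (x ∷ d ∷ base ∷ []) [])
                     (Dir-⊕ _ _ (∈⇒Dir x x∈) d∈))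

  Diff⇒Dir : ∀ x → Diff U x → T (Dir x)
  Diff⇒Dir _ (a , b , a∈ , b∈ , refl) = ⊝∈Dir a b a∈ b∈

  Dir⇒Diff : ∀ x → T (Dir x) → Diff U x
  Dir⇒Diff x x∈ =
    x ⊕ base , base ,
    ∈-resp U (solve (v₁ ⊕ᵗ v₀) (v₀ ⊕ᵗ v₁) tt (x ∷ base ∷ []) []) (⊕Dir∈ base x base∈ x∈) ,
    base∈ , solve v₀ (v₀ ⊕ᵗ v₁ ⊝ᵗ v₁) tt (x ∷ base ∷ []) []

  −U+−U⊆U : ∀ x y → T (U (⊖ x)) → T (U (⊖ y)) → T (U (x ⊕ y))
  −U+−U⊆U x y x∈ y∈ =
    Dir⇒∈ _ (∈-resp Dir (solve (⊖ᵗ ((⊖ᵗ v₀ ⊝ᵗ v₂) ⊕ᵗ (⊖ᵗ v₁ ⊝ᵗ v₂))) (v₀ ⊕ᵗ v₁ ⊝ᵗ v₂) tt (x ∷ y ∷ base ∷ []) [])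
                     (Dir-⊖ _ (Dir-⊕ _ _ (∈⇒Dir _ x∈) (∈⇒Dir _ y∈))))

  U+U⊆−U : ∀ x y → T (U x) → T (U y) → T (U (⊖ (x ⊕ y)))
  U+U⊆−U x y x∈ y∈ =
    Dir⇒∈ _ (∈-resp Dir (solve (⊖ᵗ ((v₀ ⊝ᵗ v₂) ⊕ᵗ (v₁ ⊝ᵗ v₂))) (⊖ᵗ (v₀ ⊕ᵗ v₁) ⊝ᵗ v₂) tt (x ∷ y ∷ base ∷ []) [])
                     (Dir-⊖ _ (Dir-⊕ _ _ (∈⇒Dir _ x∈) (∈⇒Dir _ y∈))))

  U+−U⊆Dir : ∀ x y → T (U x) → T (U (⊖ y)) → T (Dir (x ⊕ y))
  U+−U⊆Dir x y x∈ y∈ =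
    ∈-resp Dir (solve ((v₀ ⊝ᵗ v₂) ⊝ᵗ (⊖ᵗ v₁ ⊝ᵗ v₂)) (v₀ ⊕ᵗ v₁) tt (x ∷ y ∷ base ∷ []) [])
           (Dir-⊝ _ _ (∈⇒Dir _ x∈) (∈⇒Dir _ y∈))

  card-Dir : card Dir ≡ card U
  card-Dir = trans (card-cong {P = Dir} {λ x → U (x ⊕ base)} λ x → T-ext
                      (λ d → Dir⇒∈ _ (∈-resp Dir (solve v₀ (v₀ ⊕ᵗ v₁ ⊝ᵗ v₁) tt (x ∷ base ∷ []) []) d))
                      (λ u → ∈-resp Dir (solve (v₀ ⊕ᵗ v₁ ⊝ᵗ v₁) v₀ tt (x ∷ base ∷ []) []) (∈⇒Dir _ u)))
                   (card-translate U base)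

  -- C(U) = [U] ∪ U ∪ (−U)
  Layers : V n → Set
  Layers x = T (Dir x) ⊎ T (U x) ⊎ T (U (⊖ x))

  layers-of-multiple : ∀ x c → T (Dir (x ⊝ c · base)) → Layers x
  layers-of-multiple x f0 d = inj₁ (∈-resp Dir (solve (v₀ ⊝ᵗ con f0 ·ᵗ v₁) v₀ tt (x ∷ base ∷ []) []) d)
  layers-of-multiple x f1 d =
    inj₂ (inj₁ (Dir⇒∈ x (∈-resp Dir (solve (v₀ ⊝ᵗ con f1 ·ᵗ v₁) (v₀ ⊝ᵗ v₁) tt (x ∷ base ∷ []) []) d)))
  layers-of-multiple x f2 d =
    inj₂ (inj₂ (Dir⇒∈ _ (∈-resp Dir (solve (⊖ᵗ (v₀ ⊝ᵗ con f2 ·ᵗ v₁)) (⊖ᵗ v₀ ⊝ᵗ v₁) tt (x ∷ base ∷ []) [])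
                                    (Dir-⊖ _ d))))

  span-offset : ∀ cs → All (λ q → T (U (proj₂ q))) cs → T (Dir (sumL cs ⊝ sumC cs · base))
  span-offset [] [] = ∈-resp Dir (solve 𝟎ᵗ (𝟎ᵗ ⊝ᵗ con f0 ·ᵗ v₀) tt (base ∷ []) []) Dir-𝟎
  span-offset ((c , v) ∷ cs) (v∈ ∷ cs∈) =
    ∈-resp Dir (solve (σ₀ ·ᵗ (v₀ ⊝ᵗ v₂) ⊕ᵗ (v₁ ⊝ᵗ σ₁ ·ᵗ v₂)) ((σ₀ ·ᵗ v₀ ⊕ᵗ v₁) ⊝ᵗ (σ₀ +ˢ σ₁) ·ᵗ v₂) tt
                      (v ∷ sumL cs ∷ base ∷ []) (c ∷ sumC cs ∷ []))
           (Dir-⊕ _ _ (Dir-· c _ (∈⇒Dir v v∈)) (span-offset cs cs∈))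

  span⇒layers : ∀ x → InSpan (λ y → T (U y)) x → Layers x
  span⇒layers _ (cs , cs∈ , refl) = layers-of-multiple (sumL cs) (sumC cs) (span-offset cs cs∈)

  layers⇒span : ∀ x → Layers x → InSpan (λ y → T (U y)) x
  layers⇒span x (inj₁ d) =
    (f1 , x ⊕ base) ∷ (f2 , base) ∷ [] ,
    ∈-resp U (solve (v₁ ⊕ᵗ v₀) (v₀ ⊕ᵗ v₁) tt (x ∷ base ∷ []) []) (⊕Dir∈ base x base∈ d) ∷ base∈ ∷ [] ,
    solve v₀ (con f1 ·ᵗ (v₀ ⊕ᵗ v₁) ⊕ᵗ (con f2 ·ᵗ v₁ ⊕ᵗ 𝟎ᵗ)) tt (x ∷ base ∷ []) []
  layers⇒span x (inj₂ (inj₁ u)) = (f1 , x) ∷ [] , u ∷ [] , solve v₀ (con f1 ·ᵗ v₀ ⊕ᵗ 𝟎ᵗ) tt (x ∷ []) []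
  layers⇒span x (inj₂ (inj₂ u)) =
    (f2 , ⊖ x) ∷ [] , u ∷ [] , solve v₀ (con f2 ·ᵗ (⊖ᵗ v₀) ⊕ᵗ 𝟎ᵗ) tt (x ∷ []) []

  module AvoidingZero (𝟎∉U : ¬ T (U 𝟎)) where

    base∉Dir : ¬ T (Dir base)
    base∉Dir b∈ = 𝟎∉U (Dir⇒∈ 𝟎 (∈-resp Dir (solve (⊖ᵗ v₀) (𝟎ᵗ ⊝ᵗ v₀) tt (base ∷ []) []) (Dir-⊖ base b∈)))

    Dir∩U=∅ : ∀ x → T (Dir x) → ¬ T (U x)
    Dir∩U=∅ x d u = base∉Dir (∈-resp Dir (solve (v₀ ⊝ᵗ (v₀ ⊝ᵗ v₁)) v₁ tt (x ∷ base ∷ []) []) (Dir-⊝ _ _ d (∈⇒Dir x u)))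

    Dir∩−U=∅ : ∀ x → T (Dir x) → ¬ T (U (⊖ x))
    Dir∩−U=∅ x d = Dir∩U=∅ (⊖ x) (Dir-⊖ x d)

    U∩−U=∅ : ∀ x → T (U x) → ¬ T (U (⊖ x))
    U∩−U=∅ x u u⁻ = Dir∩U=∅ x (∈-resp Dir (solve (con f2 ·ᵗ (v₀ ⊝ᵗ ⊖ᵗ v₀)) v₀ tt (x ∷ []) []) (Dir-· f2 _ (⊝∈Dir x (⊖ x) u u⁻))) u

    card-layers : ∀ (Q : Subset n) → (∀ x → T (Q x) → Layers x) → (∀ x → Layers x → T (Q x)) →
                  card Q ≡ 3 * card U
    card-layers Q Q⇒layers layers⇒Q = begin
      card Q                                            ≡⟨ card-cong (λ x → T-ext (to ∘ Q⇒layers x) (layers⇒Q x ∘ from)) ⟩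
      card (λ x → Dir x ∨ (U x ∨ U (⊖ x)))              ≡⟨ countB-∨ Dir _ Dir∩layers=∅ (allV n) ⟩
      card Dir + card (λ x → U x ∨ U (⊖ x))             ≡⟨ cong (card Dir +_) (countB-∨ U _ U∩−U=∅ (allV n)) ⟩
      card Dir + (card U + card (λ x → U (⊖ x)))        ≡⟨ cong₂ (λ a b → a + (card U + b)) card-Dir (card-negate U) ⟩
      card U + (card U + card U)                        ≡⟨ thrice (card U) ⟩
      3 * card U                                        ∎
      where
      open ≡-Reasoning
      thrice : ∀ a → a + (a + a) ≡ 3 * a
      thrice = solve-∀
      to : ∀ {x} → Layers x → T (Dir x ∨ (U x ∨ U (⊖ x)))
      to     (inj₁ d)        = ∨-introˡ d
      to {x} (inj₂ (inj₁ u)) = ∨-introʳ {Dir x} (∨-introˡ u)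
      to {x} (inj₂ (inj₂ u)) = ∨-introʳ {Dir x} (∨-introʳ {U x} u)
      from : ∀ {x} → T (Dir x ∨ (U x ∨ U (⊖ x))) → Layers x
      from {x} t with ∨-elim {Dir x} t
      ... | inj₁ d = inj₁ d
      ... | inj₂ t′ = inj₂ (∨-elim {U x} t′)
      Dir∩layers=∅ : ∀ x → T (Dir x) → T (U x ∨ U (⊖ x)) → ⊥
      Dir∩layers=∅ x d t with ∨-elim {U x} t
      ... | inj₁ u  = Dir∩U=∅ x d u
      ... | inj₂ u⁻ = Dir∩−U=∅ x d u⁻

module Hyperplane {n} {L H : Subset n} (hyperplane : IsHyperplaneIn L H) (𝟎∉H : ¬ T (H 𝟎)) where

  open AffineSubspace (proj₁ hyperplane) public
  open AvoidingZero 𝟎∉H public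

  H⊆L : H ⊆ L
  H⊆L = proj₁ (proj₂ hyperplane)

  d : ℕ
  d = proj₁ (proj₂ (proj₂ hyperplane))

  dim-H : AffDim H d
  dim-H = proj₁ (proj₂ (proj₂ (proj₂ hyperplane)))

  dim-L : HasDim (λ x → T (L x)) (suc d)
  dim-L = proj₂ (proj₂ (proj₂ (proj₂ hyperplane)))

  L-lin : ∀ a b x y → T (L x) → T (L y) → T (L (a · x ⊕ b · y))
  L-lin = HasDim-closed dim-L

  Dir⊆L : Dir ⊆ L
  Dir⊆L x d∈ = ∈-resp L (solve (con f1 ·ᵗ (v₁ ⊕ᵗ v₀) ⊕ᵗ con f2 ·ᵗ v₁) v₀ tt (x ∷ base ∷ []) [])
                        (L-lin f1 f2 _ _ (H⊆L _ (⊕Dir∈ base x base∈ d∈)) (H⊆L base base∈))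

  layers⇒L : ∀ x → Layers x → T (L x)
  layers⇒L x (inj₁ d∈)        = Dir⊆L x d∈
  layers⇒L x (inj₂ (inj₁ h))  = H⊆L x h
  layers⇒L x (inj₂ (inj₂ h⁻)) = ∈-resp L (solve (con f2 ·ᵗ (⊖ᵗ v₀) ⊕ᵗ con f0 ·ᵗ (⊖ᵗ v₀)) v₀ tt (x ∷ []) [])
                                           (L-lin f2 f0 _ _ (H⊆L _ h⁻) (H⊆L _ h⁻))

  Dir-relation : ∀ {t r w} α β → w ≡ 𝟎 → t ≡ α · w ⊕ β · r → T (Dir r) → T (Dir t)
  Dir-relation {t} {r} α β refl t≡ r∈ =
    ∈-resp Dir (sym (trans t≡ (solve (σ₀ ·ᵗ 𝟎ᵗ ⊕ᵗ σ₁ ·ᵗ v₀) (σ₁ ·ᵗ v₀) tt (r ∷ []) (α ∷ β ∷ []))))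
           (Dir-· β r r∈)

  dependence-layers : ∀ c₀ c₁ x r → c₀ · x ⊕ (c₁ · base ⊕ r) ≡ 𝟎 → T (Dir r) →
                      (c₀ ≡ f0 × c₁ ≡ f0 × r ≡ 𝟎) ⊎ Layers x
  dependence-layers f0 f0 x r w≡0 _ =
    inj₁ (refl , refl , trans (solve v₂ (con f0 ·ᵗ v₀ ⊕ᵗ (con f0 ·ᵗ v₁ ⊕ᵗ v₂)) tt (x ∷ base ∷ r ∷ []) []) w≡0)
  dependence-layers f0 f1 x r w≡0 r∈ = ⊥-elim (base∉Dir (Dir-relation f1 f2 w≡0
    (solve v₁ (con f1 ·ᵗ (con f0 ·ᵗ v₀ ⊕ᵗ (con f1 ·ᵗ v₁ ⊕ᵗ v₂)) ⊕ᵗ con f2 ·ᵗ v₂) tt (x ∷ base ∷ r ∷ []) []) r∈))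
  dependence-layers f0 f2 x r w≡0 r∈ = ⊥-elim (base∉Dir (Dir-relation f2 f1 w≡0
    (solve v₁ (con f2 ·ᵗ (con f0 ·ᵗ v₀ ⊕ᵗ (con f2 ·ᵗ v₁ ⊕ᵗ v₂)) ⊕ᵗ con f1 ·ᵗ v₂) tt (x ∷ base ∷ r ∷ []) []) r∈))
  dependence-layers f1 c₁ x r w≡0 r∈ = inj₂ (layers-of-multiple x (-₃ c₁) (Dir-relation f1 f2 w≡0
    (solve (v₀ ⊝ᵗ (-ˢ σ₀) ·ᵗ v₁) (con f1 ·ᵗ (con f1 ·ᵗ v₀ ⊕ᵗ (σ₀ ·ᵗ v₁ ⊕ᵗ v₂)) ⊕ᵗ con f2 ·ᵗ v₂) tt
           (x ∷ base ∷ r ∷ []) (c₁ ∷ [])) r∈))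
  dependence-layers f2 c₁ x r w≡0 r∈ = inj₂ (layers-of-multiple x c₁ (Dir-relation f2 f1 w≡0
    (solve (v₀ ⊝ᵗ σ₀ ·ᵗ v₁) (con f2 ·ᵗ (con f2 ·ᵗ v₀ ⊕ᵗ (σ₀ ·ᵗ v₁ ⊕ᵗ v₂)) ⊕ᵗ con f1 ·ᵗ v₂) tt
           (x ∷ base ∷ r ∷ []) (c₁ ∷ [])) r∈))

  basis-H : Vec (V n) d
  basis-H = proj₁ dim-H

  L-in-span : ∀ v → T (L v) → InSpanOf (proj₁ dim-L) v
  L-in-span v = proj₁ (proj₂ (proj₂ dim-L) v)

  L⇒layers : ∀ x → T (L x) → Layers x
  L⇒layers x x∈L with dependent-in-span (proj₁ dim-L) {x ∷ base ∷ basis-H}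
                        (L-in-span x x∈L ∷ L-in-span base (H⊆L base base∈)
                          ∷ Allᵥ.map (λ {v} v∈ → L-in-span v (Dir⊆L v (Diff⇒Dir v v∈))) (basis-spans dim-H))
                        (n<1+n (suc d))
  ... | c₀ ∷ c₁ ∷ c , c≢0 , Σ≡0
    with dependence-layers c₀ c₁ x (lincomb c basis-H) Σ≡0 (Diff⇒Dir _ (proj₂ (proj₂ (proj₂ dim-H) _) (c , refl)))
  ... | inj₂ layers               = layers
  ... | inj₁ (refl , refl , Σc≡0) = ⊥-elim (c≢0 (cong (λ c′ → f0 ∷ f0 ∷ c′) (proj₁ (proj₂ dim-H) c Σc≡0)))

  card-L : card L ≡ 3 * card H
  card-L = card-layers L L⇒layers layers⇒L

Adjoin : ∀ {n} → Subset n → V n → V n → Set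
Adjoin A x y = T (A y) ⊎ y ≡ x

HasSum : ∀ {n} → (V n → Set) → Set
HasSum {n} S = ∃ λ (a : V n) → ∃ λ b → ∃ λ c → S a × S b × S c × a ⊕ b ≡ c

record MaximalSumFreeIn {n} (L A : Subset n) : Set where
  field
    A⊆L     : A ⊆ L
    sumFree : SumFree A
    maximal : ∀ x → T (L x) → ¬ T (A x) → HasSum (Adjoin A x)

CardIdentity : ∀ {n} → Subset n → Subset n → Set
CardIdentity L A = card A * 6 ≡ card L + 3 * card (Sym A)

HasSum-mono : ∀ {n} {S S′ : V n → Set} → (∀ {y} → S y → S′ y) → HasSum S → HasSum S′
HasSum-mono S⊆S′ (a , b , c , a∈ , b∈ , c∈ , a+b≡c) = a , b , c , S⊆S′ a∈ , S⊆S′ b∈ , S⊆S′ c∈ , a+b≡c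

maximalSumFree : ∀ {n} {A : Subset n} → MaximalSumFreeIn full A → MaximalSumFree A
maximalSumFree {A = A} msf = sumFree , A-maximal
  where
  open MaximalSumFreeIn msf
  A-maximal : ∀ B → SumFree B → A ⊆ B → B ⊆ A
  A-maximal B B-sumFree A⊆B y y∈B with T? (A y)
  ... | yes y∈A = y∈A
  ... | no  y∉A with maximal y tt y∉A
  ...   | a , b , c , a∈ , b∈ , c∈ , refl = ⊥-elim (B-sumFree a b (toB a∈) (toB b∈) (toB c∈))
    where
    toB : ∀ {z} → Adjoin A y z → T (B z)
    toB (inj₁ z∈A) = A⊆B _ z∈A
    toB (inj₂ refl) = y∈B

module HyperplaneCase {n} {L A : Subset n} (hyperplane : IsHyperplaneIn L A) (𝟎∉A : ¬ T (A 𝟎)) where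

  open Hyperplane hyperplane 𝟎∉A

  sumFree : SumFree A
  sumFree x y x∈ y∈ x+y∈ = U∩−U=∅ (x ⊕ y) x+y∈ (U+U⊆−U x y x∈ y∈)

  maximal : ∀ x → T (L x) → ¬ T (A x) → HasSum (Adjoin A x)
  maximal x x∈L x∉A with L⇒layers x x∈L
  ... | inj₁ d∈       = base , x , base ⊕ x , inj₁ base∈ , inj₂ refl , inj₁ (⊕Dir∈ base x base∈ d∈) , refl
  ... | inj₂ (inj₁ a) = ⊥-elim (x∉A a)
  ... | inj₂ (inj₂ a⁻) = x , x , ⊖ x , inj₂ refl , inj₂ refl , inj₁ a⁻ , solve (v₀ ⊕ᵗ v₀) (⊖ᵗ v₀) tt (x ∷ []) []

  maximalSumFreeIn : MaximalSumFreeIn L A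
  maximalSumFreeIn = record { A⊆L = H⊆L ; sumFree = sumFree ; maximal = maximal }

  Sym≡Dir : ∀ t → Sym A t ≡ Dir t
  Sym≡Dir t = T-ext Sym⇒Dir Dir⇒Sym
    where
    Sym⇒Dir : T (Sym A t) → T (Dir t)
    Sym⇒Dir t∈ = ∈-resp Dir (solve (v₀ ⊕ᵗ v₁ ⊝ᵗ v₀) v₁ tt (base ∷ t ∷ []) [])
      (∈⇒Dir _ (subst T (Sym-sound A t t∈ (base ⊕ t))
                  (∈-resp A (solve v₀ (v₀ ⊕ᵗ v₁ ⊝ᵗ v₁) tt (base ∷ t ∷ []) []) base∈)))
    Dir⇒Sym : T (Dir t) → T (Sym A t)
    Dir⇒Sym d∈ = Sym-complete A t λ y → T-ext
      (λ y-t∈ → ∈-resp A (solve (v₀ ⊝ᵗ v₁ ⊕ᵗ v₁) v₀ tt (y ∷ t ∷ []) []) (⊕Dir∈ _ t y-t∈ d∈))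
      (λ y∈ → ⊕Dir∈ y (⊖ t) y∈ (Dir-⊖ t d∈))

  card-identity : CardIdentity L A
  card-identity rewrite card-L | card-cong Sym≡Dir | card-Dir = six (card A)
    where
    six : ∀ a → a * 6 ≡ 3 * a + 3 * a
    six = solve-∀

CodimAtLeast2 : ∀ {n} → Subset n → Subset n → Set
CodimAtLeast2 H U = Σ ℕ λ dH → Σ ℕ λ dU → AffDim H dH × AffDim U dU × dU + 2 ≤ dH

all-or-counterexample : ∀ {n k} {Q : V n → Set} (P : Subset n) {bs : Vec (V n) k} → Allᵥ Q bs →
                        (∃ λ v → Q v × ¬ T (P v)) ⊎ Allᵥ (T ∘ P) bs
all-or-counterexample P []                 = inj₂ []
all-or-counterexample P {v ∷ _} (q ∷ qs) with T? (P v) | all-or-counterexample P qs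
... | no  v∉P | _                = inj₁ (v , q , v∉P)
... | yes v∈P | inj₁ ce          = inj₁ ce
... | yes v∈P | inj₂ all∈P       = inj₂ (v∈P ∷ all∈P)

-- s − x, s, s + x is a coset of ⟨x⟩ (characteristic 3), and so is its negative; two of the three
-- chosen representatives lie in the same coset, and two distinct elements of it have the form t, t + x.
consecutive-pair : ∀ {n} (S : V n → Set) (s x : V n) →
  (S (s ⊝ x) ⊎ S (⊖ (s ⊝ x))) → (S s ⊎ S (⊖ s)) → (S (s ⊕ x) ⊎ S (⊖ (s ⊕ x))) →
  ∃ λ t → S t × S (t ⊕ x)
consecutive-pair S s x (inj₁ a) (inj₁ b) _ = s ⊝ x , a , subst S (solve v₀ (v₀ ⊝ᵗ v₁ ⊕ᵗ v₁) tt (s ∷ x ∷ []) []) b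
consecutive-pair S s x _ (inj₁ b) (inj₁ c) = s , b , c
consecutive-pair S s x (inj₁ a) (inj₂ b) (inj₁ c) =
  s ⊕ x , c , subst S (solve (v₀ ⊝ᵗ v₁) (v₀ ⊕ᵗ v₁ ⊕ᵗ v₁) tt (s ∷ x ∷ []) []) a
consecutive-pair S s x (inj₁ a) (inj₂ b) (inj₂ c) =
  ⊖ (s ⊕ x) , c , subst S (solve (⊖ᵗ v₀) (⊖ᵗ (v₀ ⊕ᵗ v₁) ⊕ᵗ v₁) tt (s ∷ x ∷ []) []) b
consecutive-pair S s x (inj₂ a) (inj₁ b) (inj₂ c) =
  ⊖ (s ⊝ x) , a , subst S (solve (⊖ᵗ (v₀ ⊕ᵗ v₁)) (⊖ᵗ (v₀ ⊝ᵗ v₁) ⊕ᵗ v₁) tt (s ∷ x ∷ []) []) c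
consecutive-pair S s x (inj₂ a) (inj₂ b) (inj₁ c) =
  ⊖ s , b , subst S (solve (⊖ᵗ (v₀ ⊝ᵗ v₁)) (⊖ᵗ v₀ ⊕ᵗ v₁) tt (s ∷ x ∷ []) []) a
consecutive-pair S s x (inj₂ a) (inj₂ b) (inj₂ c) =
  ⊖ (s ⊕ x) , c , subst S (solve (⊖ᵗ v₀) (⊖ᵗ (v₀ ⊕ᵗ v₁) ⊕ᵗ v₁) tt (s ∷ x ∷ []) []) b

module Composite {n} {L A : Subset n} (H U W X CU : Subset n)
  (hyperplane : IsHyperplaneIn L H) (𝟎∉H : ¬ T (H 𝟎))
  (affine : IsAffine U) (U⊆H : U ⊆ H) (half : IsHalf H U W)
  (CU⇔span : ∀ x → T (CU x) iff InSpan (λ y → T (U y)) x)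
  (A≡W∪X : ∀ x → A x ≡ (W x ∨ X x))
  (X∩[U]=∅ : ∀ x → T (X x) → ¬ Diff U x)
  (aff[X∩−U]=−U : ∀ x → InAff (λ y → T (X y) × Neg U y) x iff Neg U x)
  (X⊆CU : X ⊆ CU)
  where

  module ℍ = Hyperplane hyperplane 𝟎∉H
  module 𝕌 = AffineSubspace affine
  open 𝕌.AvoidingZero (λ 𝟎∈U → 𝟎∉H (U⊆H 𝟎 𝟎∈U))

  u₀ : V n
  u₀ = 𝕌.base

  W-shift : ∀ w d → T (W w) → T (𝕌.Dir d) → T (W (w ⊕ d))
  W-shift w d w∈ d∈ = proj₁ (proj₁ half (w ⊕ d)) (w , d , w∈ , 𝕌.Dir⇒Diff d d∈ , refl)

  H⇒parts : ∀ x → T (H x) → T (U x) ⊎ T (W x) ⊎ NegSum U W x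
  H⇒parts x = proj₁ (proj₁ (proj₂ half) x)

  parts⇒H : ∀ x → T (U x) ⊎ T (W x) ⊎ NegSum U W x → T (H x)
  parts⇒H x = proj₂ (proj₁ (proj₂ half) x)

  W⊆H : W ⊆ H
  W⊆H x w∈ = parts⇒H x (inj₂ (inj₁ w∈))

  U∩W=∅ : ∀ x → T (U x) → ¬ T (W x)
  U∩W=∅ = proj₁ (proj₂ (proj₂ half))

  U∩NegSum=∅ : ∀ x → T (U x) → ¬ NegSum U W x
  U∩NegSum=∅ = proj₁ (proj₂ (proj₂ (proj₂ half)))

  W∩NegSum=∅ : ∀ x → T (W x) → ¬ NegSum U W x
  W∩NegSum=∅ = proj₂ (proj₂ (proj₂ (proj₂ half)))

  -- (−U) + (−W) = −u₀ − W, since W + [U] = W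
  NegSum⇒W : ∀ x → NegSum U W x → T (W (⊖ x ⊝ u₀))
  NegSum⇒W _ (u , w , u∈ , w∈ , refl) =
    ∈-resp W (solve (v₁ ⊕ᵗ (v₀ ⊝ᵗ v₂)) (⊖ᵗ (⊖ᵗ v₀ ⊕ᵗ ⊖ᵗ v₁) ⊝ᵗ v₂) tt (u ∷ w ∷ u₀ ∷ []) [])
           (W-shift w _ w∈ (𝕌.∈⇒Dir u u∈))

  W⇒NegSum : ∀ x → T (W (⊖ x ⊝ u₀)) → NegSum U W x
  W⇒NegSum x w∈ = u₀ , ⊖ x ⊝ u₀ , 𝕌.base∈ , w∈ , solve v₀ (⊖ᵗ v₁ ⊕ᵗ ⊖ᵗ (⊖ᵗ v₀ ⊝ᵗ v₁)) tt (x ∷ u₀ ∷ []) []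

  A⇒W⊎X : ∀ x → T (A x) → T (W x) ⊎ T (X x)
  A⇒W⊎X x a∈ = ∨-elim (subst T (A≡W∪X x) a∈)

  W⊆A : W ⊆ A
  W⊆A x w∈ = subst T (sym (A≡W∪X x)) (∨-introˡ w∈)

  X⊆A : X ⊆ A
  X⊆A x x∈ = subst T (sym (A≡W∪X x)) (∨-introʳ {W x} x∈)

  layers⇒CU : ∀ x → 𝕌.Layers x → T (CU x)
  layers⇒CU x layers = proj₂ (CU⇔span x) (𝕌.layers⇒span x layers)

  X⊆U∪−U : ∀ x → T (X x) → T (U x) ⊎ T (U (⊖ x))
  X⊆U∪−U x x∈ with 𝕌.span⇒layers x (proj₁ (CU⇔span x) (X⊆CU x x∈))
  ... | inj₁ d∈    = ⊥-elim (X∩[U]=∅ x x∈ (𝕌.Dir⇒Diff x d∈))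
  ... | inj₂ ±U    = ±U

  W∩X=∅ : ∀ x → T (W x) → ¬ T (X x)
  W∩X=∅ x w∈ x∈ with X⊆U∪−U x x∈
  ... | inj₁ u∈  = U∩W=∅ x u∈ w∈
  ... | inj₂ u⁻∈ = ℍ.U∩−U=∅ x (W⊆H x w∈) (U⊆H _ u⁻∈)

  A⊆H∪−H : ∀ x → T (A x) → T (H x) ⊎ T (H (⊖ x))
  A⊆H∪−H x a∈ with A⇒W⊎X x a∈
  ... | inj₁ w∈ = inj₁ (W⊆H x w∈)
  ... | inj₂ x∈ with X⊆U∪−U x x∈
  ...   | inj₁ u∈  = inj₁ (U⊆H x u∈)
  ...   | inj₂ u⁻∈ = inj₂ (U⊆H _ u⁻∈)

  [H]∩A=∅ : ∀ x → T (ℍ.Dir x) → ¬ T (A x)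
  [H]∩A=∅ x d∈ a∈ with A⊆H∪−H x a∈
  ... | inj₁ h∈  = ℍ.Dir∩U=∅ x d∈ h∈
  ... | inj₂ h⁻∈ = ℍ.Dir∩−U=∅ x d∈ h⁻∈

  A∩H⊆W∪X∩U : ∀ x → T (H x) → T (A x) → T (W x) ⊎ (T (X x) × T (U x))
  A∩H⊆W∪X∩U x h∈ a∈ with A⇒W⊎X x a∈
  ... | inj₁ w∈ = inj₁ w∈
  ... | inj₂ x∈ with X⊆U∪−U x x∈
  ...   | inj₁ u∈  = inj₂ (x∈ , u∈)
  ...   | inj₂ u⁻∈ = ⊥-elim (ℍ.U∩−U=∅ x h∈ (U⊆H _ u⁻∈))

  A∩−H⊆X∩−U : ∀ x → T (H (⊖ x)) → T (A x) → T (X x) × T (U (⊖ x))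
  A∩−H⊆X∩−U x h⁻∈ a∈ with A⇒W⊎X x a∈
  ... | inj₁ w∈ = ⊥-elim (ℍ.U∩−U=∅ x (W⊆H x w∈) h⁻∈)
  ... | inj₂ x∈ with X⊆U∪−U x x∈
  ...   | inj₁ u∈  = ⊥-elim (ℍ.U∩−U=∅ x (U⊆H x u∈) h⁻∈)
  ...   | inj₂ u⁻∈ = x∈ , u⁻∈

  module SumFreeness (X-sumFree : SumFree X) where

    sumFree-in-H : ∀ a c → T (H a) → T (H c) → T (A a) → T (A c) → ¬ T (A (a ⊕ c))
    sumFree-in-H a c h∈a h∈c a∈ c∈ s∈ with A∩−H⊆X∩−U (a ⊕ c) (ℍ.U+U⊆−U a c h∈a h∈c) s∈
    ... | s∈X , s⁻∈U with A∩H⊆W∪X∩U a h∈a a∈ | A∩H⊆W∪X∩U c h∈c c∈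
    ... | inj₂ (a∈X , _) | inj₂ (c∈X , _) = X-sumFree a c a∈X c∈X s∈X
    ... | inj₁ a∈W | inj₂ (_ , c∈U) =
      U∩W=∅ a (∈-resp U (solve (⊖ᵗ (⊖ᵗ (v₀ ⊕ᵗ v₁) ⊕ᵗ v₁)) v₀ tt (a ∷ c ∷ []) []) (𝕌.U+U⊆−U _ c s⁻∈U c∈U)) a∈W
    ... | inj₂ (_ , a∈U) | inj₁ c∈W =
      U∩W=∅ c (∈-resp U (solve (⊖ᵗ (⊖ᵗ (v₀ ⊕ᵗ v₁) ⊕ᵗ v₀)) v₁ tt (a ∷ c ∷ []) []) (𝕌.U+U⊆−U _ a s⁻∈U a∈U)) c∈W
    ... | inj₁ a∈W | inj₁ c∈W =
      W∩NegSum=∅ c c∈W (⊖ (a ⊕ c) , a , s⁻∈U , a∈W , solve v₁ (⊖ᵗ (⊖ᵗ (v₀ ⊕ᵗ v₁)) ⊕ᵗ ⊖ᵗ v₀) tt (a ∷ c ∷ []) [])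

    sumFree : SumFree A
    sumFree a c a∈ c∈ s∈ with A⊆H∪−H a a∈ | A⊆H∪−H c c∈
    ... | inj₁ h∈a | inj₁ h∈c = sumFree-in-H a c h∈a h∈c a∈ c∈ s∈
    ... | inj₁ h∈a | inj₂ h⁻∈c = [H]∩A=∅ _ (ℍ.U+−U⊆Dir a c h∈a h⁻∈c) s∈
    ... | inj₂ h⁻∈a | inj₁ h∈c =
      [H]∩A=∅ _ (∈-resp ℍ.Dir (solve (v₁ ⊕ᵗ v₀) (v₀ ⊕ᵗ v₁) tt (a ∷ c ∷ []) []) (ℍ.U+−U⊆Dir c a h∈c h⁻∈a)) s∈
    ... | inj₂ h⁻∈a | inj₂ h⁻∈c with A∩−H⊆X∩−U a h⁻∈a a∈ | A∩−H⊆X∩−U c h⁻∈c c∈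
    ...   | a∈X , a⁻∈U | c∈X , c⁻∈U with A⇒W⊎X _ s∈
    ...     | inj₁ s∈W = U∩W=∅ _ (𝕌.−U+−U⊆U a c a⁻∈U c⁻∈U) s∈W
    ...     | inj₂ s∈X = X-sumFree a c a∈X c∈X s∈X

  witness : ∃ λ b → T (X b) × T (U (⊖ b))
  witness with proj₂ (aff[X∩−U]=−U (⊖ u₀)) (∈-resp U (solve v₀ (⊖ᵗ (⊖ᵗ v₀)) tt (u₀ ∷ []) []) 𝕌.base∈)
  ... | []            , _        , ()   , _
  ... | (_ , b) ∷ _  , b∈ ∷ _   , _    , _ = b , b∈

  b : V n
  b = proj₁ witness

  b∈X : T (X b)
  b∈X = proj₁ (proj₂ witness)

  b∈−U : T (U (⊖ b))
  b∈−U = proj₂ (proj₂ witness)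

  module Maximality (X-msf : MaximalSumFreeIn CU X)
                    (codim⊎X≢−U : CodimAtLeast2 H U ⊎ ¬ (∀ x → T (X x) iff Neg U x)) where

    open MaximalSumFreeIn X-msf using () renaming (maximal to X-maximal)

    sum-via-X : ∀ x → 𝕌.Layers x → ¬ T (A x) → HasSum (Adjoin A x)
    sum-via-X x layers x∉A = HasSum-mono X∪x⊆A∪x (X-maximal x (layers⇒CU x layers) (x∉A ∘ X⊆A x))
      where
      X∪x⊆A∪x : ∀ {y} → Adjoin X x y → Adjoin A x y
      X∪x⊆A∪x (inj₁ y∈X) = inj₁ (X⊆A _ y∈X)
      X∪x⊆A∪x (inj₂ y≡x) = inj₂ y≡x

    -- Maximality of X in C(U) forces X = −U here, so (iii) gives codimension at least 2.
    module DisjointFromU (X∩U=∅ : ∀ y → T (X y) → ¬ T (U y)) where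

      X⊆−U : ∀ y → T (X y) → T (U (⊖ y))
      X⊆−U y y∈X with X⊆U∪−U y y∈X
      ... | inj₁ y∈U  = ⊥-elim (X∩U=∅ y y∈X y∈U)
      ... | inj₂ y∈−U = y∈−U

      −U⊆X : ∀ y → T (U (⊖ y)) → T (X y)
      −U⊆X y y∈−U with T? (X y)
      ... | yes y∈X = y∈X
      ... | no  y∉X with X-maximal y (layers⇒CU y (inj₂ (inj₂ y∈−U))) y∉X
      ...   | a , a′ , c , a∈ , a′∈ , c∈ , a+a′≡c =
        ⊥-elim (U∩−U=∅ c (∈-resp U a+a′≡c (𝕌.−U+−U⊆U a a′ (in−U a∈) (in−U a′∈))) (in−U c∈))
        where
        in−U : ∀ {z} → Adjoin X y z → T (U (⊖ z))
        in−U (inj₁ z∈X) = X⊆−U _ z∈X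
        in−U (inj₂ refl) = y∈−U

      codim≥2 : CodimAtLeast2 H U
      codim≥2 = [ id , (λ X≢−U → ⊥-elim (X≢−U λ y → X⊆−U y , −U⊆X y)) ]′ codim⊎X≢−U

    -- u₀ − t = −(u₀ + t) − u₀ in characteristic 3
    W-side : ∀ t → T (ℍ.Dir t) → ¬ T (𝕌.Dir t) → T (W (u₀ ⊕ t)) ⊎ T (W (u₀ ⊕ ⊖ t))
    W-side t t∈[H] t∉[U] with H⇒parts (u₀ ⊕ t) (ℍ.⊕Dir∈ u₀ t (U⊆H u₀ 𝕌.base∈) t∈[H])
    ... | inj₁ u∈          = ⊥-elim (t∉[U] (∈-resp 𝕌.Dir (solve ((v₀ ⊕ᵗ v₁) ⊝ᵗ v₀) v₁ tt (u₀ ∷ t ∷ []) [])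
                                                      (𝕌.⊝∈Dir _ u₀ u∈ 𝕌.base∈)))
    ... | inj₂ (inj₁ w∈)   = inj₁ w∈
    ... | inj₂ (inj₂ neg∈) =
      inj₂ (∈-resp W (solve (⊖ᵗ (v₀ ⊕ᵗ v₁) ⊝ᵗ v₀) (v₀ ⊕ᵗ ⊖ᵗ v₁) tt (u₀ ∷ t ∷ []) []) (NegSum⇒W _ neg∈))

    near-U : V n → Subset n
    near-U x v = 𝕌.Dir v ∨ (𝕌.Dir (v ⊝ x) ∨ 𝕌.Dir (v ⊕ x))

    far-point : ∀ x → CodimAtLeast2 H U → ∃ λ s → T (ℍ.Dir s) × ¬ T (near-U x s)
    far-point x (dH , dU , dim-H@(bH , bH-independent , _) , (bU , _ , U-span) , dU+2≤dH)
      with all-or-counterexample (near-U x) (basis-spans dim-H)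
    ... | inj₁ (s , s∈ , far) = s , ℍ.Diff⇒Dir s s∈ , far
    ... | inj₂ all-near with dependent-in-span (x ∷ bU) (Allᵥ.map (near⇒span _) all-near)
                               (subst (_≤ dH) (+-comm dU 2) dU+2≤dH)
      where
      coordinates : ∀ y → T (𝕌.Dir y) → InSpanOf bU y
      coordinates y y∈ = proj₁ (U-span y) (𝕌.Dir⇒Diff y y∈)
      near⇒span : ∀ v → T (near-U x v) → InSpanOf (x ∷ bU) v
      near⇒span v near with ∨-elim {𝕌.Dir v} near
      ... | inj₁ v∈ with coordinates v v∈
      ...   | μ , refl = f0 ∷ μ , solve v₁ (con f0 ·ᵗ v₀ ⊕ᵗ v₁) tt (x ∷ lincomb μ bU ∷ []) []
      near⇒span v near | inj₂ near′ with ∨-elim {𝕌.Dir (v ⊝ x)} near′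
      ... | inj₁ v-x∈ with coordinates _ v-x∈
      ...   | μ , v-x≡ = f1 ∷ μ , trans (solve v₀ (con f1 ·ᵗ v₁ ⊕ᵗ (v₀ ⊝ᵗ v₁)) tt (v ∷ x ∷ []) []) (cong (f1 · x ⊕_) v-x≡)
      near⇒span v near | inj₂ near′ | inj₂ v+x∈ with coordinates _ v+x∈
      ...   | μ , v+x≡ = f2 ∷ μ , trans (solve v₀ (con f2 ·ᵗ v₁ ⊕ᵗ (v₀ ⊕ᵗ v₁)) tt (v ∷ x ∷ []) []) (cong (f2 · x ⊕_) v+x≡)
    ...   | c , c≢0 , Σ≡0 = ⊥-elim (c≢0 (bH-independent c Σ≡0))

    sum-far-from-U : ∀ x → T (ℍ.Dir x) → ¬ T (𝕌.Dir x) → CodimAtLeast2 H U → HasSum (Adjoin A x)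
    sum-far-from-U x x∈[H] x∉[U] codim with far-point x codim
    ... | s , s∈[H] , far
      with consecutive-pair (λ t → T (W (u₀ ⊕ t))) s x
             (W-side (s ⊝ x) (ℍ.Dir-⊝ s x s∈[H] x∈[H]) (far ∘ ∨-introʳ {𝕌.Dir s} ∘ ∨-introˡ))
             (W-side s s∈[H] (far ∘ ∨-introˡ))
             (W-side (s ⊕ x) (ℍ.Dir-⊕ s x s∈[H] x∈[H]) (far ∘ ∨-introʳ {𝕌.Dir s} ∘ ∨-introʳ {𝕌.Dir (s ⊝ x)}))
    ... | t , w∈ , w′∈ =
      u₀ ⊕ t , x , u₀ ⊕ (t ⊕ x) , inj₁ (W⊆A _ w∈) , inj₂ refl , inj₁ (W⊆A _ w′∈) ,
      solve ((v₀ ⊕ᵗ v₁) ⊕ᵗ v₂) (v₀ ⊕ᵗ (v₁ ⊕ᵗ v₂)) tt (u₀ ∷ t ∷ x ∷ []) []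

    -- x − b ∈ H avoids U and W, so it lies in (−U) + (−W); shifting by c ∈ U lands in W
    difference-in-W : ∀ x c → T (ℍ.Dir x) → ¬ T (𝕌.Dir x) → ¬ T (W (x ⊝ b)) → T (U c) → T (W (c ⊝ x))
    difference-in-W x c x∈[H] x∉[U] x-b∉W c∈U with H⇒parts (x ⊝ b) x-b∈H
      where
      x-b∈H : T (H (x ⊝ b))
      x-b∈H = ∈-resp H (solve (⊖ᵗ v₁ ⊕ᵗ v₀) (v₀ ⊝ᵗ v₁) tt (x ∷ b ∷ []) []) (ℍ.⊕Dir∈ (⊖ b) x (U⊆H _ b∈−U) x∈[H])
    ... | inj₁ x-b∈U = ⊥-elim (x∉[U] (∈-resp 𝕌.Dir (solve (v₀ ⊝ᵗ v₁ ⊕ᵗ v₁) v₀ tt (x ∷ b ∷ []) [])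
                                                  (𝕌.U+−U⊆Dir _ b x-b∈U b∈−U)))
    ... | inj₂ (inj₁ x-b∈W) = ⊥-elim (x-b∉W x-b∈W)
    ... | inj₂ (inj₂ neg∈) =
      ∈-resp W (solve (⊖ᵗ (v₁ ⊝ᵗ v₂) ⊝ᵗ v₃ ⊕ᵗ (v₀ ⊕ᵗ v₃ ⊝ᵗ v₂)) (v₀ ⊝ᵗ v₁) tt (c ∷ x ∷ b ∷ u₀ ∷ []) [])
        (W-shift _ _ (NegSum⇒W _ neg∈)
          (∈-resp 𝕌.Dir (solve ((v₀ ⊝ᵗ v₂) ⊕ᵗ (⊖ᵗ v₁ ⊝ᵗ v₂)) (v₀ ⊕ᵗ v₂ ⊝ᵗ v₁) tt (c ∷ b ∷ u₀ ∷ []) [])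
                        (𝕌.Dir-⊕ _ _ (𝕌.∈⇒Dir c c∈U) (𝕌.∈⇒Dir (⊖ b) b∈−U))))

    sum-in-[H] : ∀ x → T (ℍ.Dir x) → ¬ T (A x) → HasSum (Adjoin A x)
    sum-in-[H] x x∈[H] x∉A with T? (𝕌.Dir x)
    ... | yes x∈[U] = sum-via-X x (inj₁ x∈[U]) x∉A
    ... | no  x∉[U] with T? (W (x ⊝ b))
    ...   | yes x-b∈W =
      x ⊝ b , b , x , inj₁ (W⊆A _ x-b∈W) , inj₁ (X⊆A b b∈X) , inj₂ refl , solve (v₀ ⊝ᵗ v₁ ⊕ᵗ v₁) v₀ tt (x ∷ b ∷ []) []
    ...   | no  x-b∉W with search (λ c → X c ∧ U c)
    ...     | inj₁ (c , c∈) =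
      let c∈X , c∈U = Equivalence.to (T-∧ {X c}) c∈ in
      c ⊝ x , x , c , inj₁ (W⊆A _ (difference-in-W x c x∈[H] x∉[U] x-b∉W c∈U)) , inj₂ refl , inj₁ (X⊆A c c∈X) ,
      solve (v₀ ⊝ᵗ v₁ ⊕ᵗ v₁) v₀ tt (c ∷ x ∷ []) []
    ...     | inj₂ none = sum-far-from-U x x∈[H] x∉[U] (DisjointFromU.codim≥2 X∩U=∅)
      where
      X∩U=∅ : ∀ y → T (X y) → ¬ T (U y)
      X∩U=∅ y y∈X y∈U = none y (Equivalence.from T-∧ (y∈X , y∈U))

    maximal : ∀ x → T (L x) → ¬ T (A x) → HasSum (Adjoin A x)
    maximal x x∈L x∉A with ℍ.L⇒layers x x∈L
    ... | inj₁ x∈[H] = sum-in-[H] x x∈[H] x∉A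
    ... | inj₂ (inj₁ x∈H) with H⇒parts x x∈H
    ...   | inj₁ x∈U       = sum-via-X x (inj₂ (inj₁ x∈U)) x∉A
    ...   | inj₂ (inj₁ x∈W) = ⊥-elim (x∉A (W⊆A x x∈W))
    ...   | inj₂ (inj₂ (u , w , u∈ , w∈ , refl)) =
      x , b ⊝ x , b , inj₂ refl , inj₁ (W⊆A _ b-x∈W) , inj₁ (X⊆A b b∈X) , solve (v₀ ⊕ᵗ (v₁ ⊝ᵗ v₀)) v₁ tt (x ∷ b ∷ []) []
      where
      b-x∈W : T (W (b ⊝ (⊖ u ⊕ ⊖ w)))
      b-x∈W = ∈-resp W (solve (v₁ ⊕ᵗ (v₀ ⊕ᵗ v₂)) (v₂ ⊝ᵗ (⊖ᵗ v₀ ⊕ᵗ ⊖ᵗ v₁)) tt (u ∷ w ∷ b ∷ []) [])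
                       (W-shift w _ w∈ (𝕌.U+−U⊆Dir u b u∈ b∈−U))
    maximal x x∈L x∉A | inj₂ (inj₂ x∈−H) with H⇒parts (⊖ x) x∈−H
    ...   | inj₁ x∈−U        = sum-via-X x (inj₂ (inj₂ x∈−U)) x∉A
    ...   | inj₂ (inj₁ x∈−W) =
      x , x , ⊖ x , inj₂ refl , inj₂ refl , inj₁ (W⊆A _ x∈−W) , solve (v₀ ⊕ᵗ v₀) (⊖ᵗ v₀) tt (x ∷ []) []
    ...   | inj₂ (inj₂ (u , w , u∈ , w∈ , −x≡)) =
      x , b , x ⊕ b , inj₂ refl , inj₁ (X⊆A b b∈X) , inj₁ (W⊆A _ x+b∈W) , refl
      where
      x+b∈W : T (W (x ⊕ b))
      x+b∈W = ∈-resp W (trans (solve (v₁ ⊕ᵗ (v₀ ⊕ᵗ v₂)) (⊖ᵗ (⊖ᵗ v₀ ⊕ᵗ ⊖ᵗ v₁) ⊕ᵗ v₂) tt (u ∷ w ∷ b ∷ []) [])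
                              (trans (cong (λ z → ⊖ z ⊕ b) (sym −x≡)) (solve (⊖ᵗ (⊖ᵗ v₀) ⊕ᵗ v₁) (v₀ ⊕ᵗ v₁) tt (x ∷ b ∷ []) [])))
                       (W-shift w _ w∈ (𝕌.U+−U⊆Dir u b u∈ b∈−U))

  A⊆L : A ⊆ L
  A⊆L x a∈ = ℍ.layers⇒L x (inj₂ (A⊆H∪−H x a∈))

  maximalSumFreeIn : MaximalSumFreeIn CU X → CodimAtLeast2 H U ⊎ ¬ (∀ x → T (X x) iff Neg U x) →
                     MaximalSumFreeIn L A
  maximalSumFreeIn X-msf codim⊎X≢−U = record
    { A⊆L     = A⊆L
    ; sumFree = SumFreeness.sumFree (MaximalSumFreeIn.sumFree X-msf)
    ; maximal = Maximality.maximal X-msf codim⊎X≢−U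
    }

  W-periodic : ∀ t → T (𝕌.Dir t) → ∀ y → W (y ⊝ t) ≡ W y
  W-periodic t t∈ y = T-ext
    (λ w∈ → ∈-resp W (solve (v₀ ⊝ᵗ v₁ ⊕ᵗ v₁) v₀ tt (y ∷ t ∷ []) []) (W-shift _ t w∈ t∈))
    (λ w∈ → W-shift y (⊖ t) w∈ (𝕌.Dir-⊖ t t∈))

  b+period∈A : ∀ t → T (Sym A t) → T (A (b ⊕ t))
  b+period∈A t t∈ =
    subst T (Sym-sound A t t∈ (b ⊕ t)) (∈-resp A (solve v₀ (v₀ ⊕ᵗ v₁ ⊝ᵗ v₁) tt (b ∷ t ∷ []) []) (X⊆A b b∈X))

  -- b ± t ∈ A, and b + t ∈ H would put (−b) − (b + t) = b − t in [H] ∩ A; so b + t ∈ −U and t ∈ [U].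
  period-of-A : ∀ t → T (Sym A t) → T (𝕌.Dir t)
  period-of-A t t∈ with A⊆H∪−H (b ⊕ t) (b+period∈A t t∈)
  ... | inj₁ b+t∈H = ⊥-elim ([H]∩A=∅ (b ⊝ t)
         (∈-resp ℍ.Dir (solve (⊖ᵗ v₀ ⊝ᵗ (v₀ ⊕ᵗ v₁)) (v₀ ⊝ᵗ v₁) tt (b ∷ t ∷ []) []) (ℍ.⊝∈Dir _ _ (U⊆H _ b∈−U) b+t∈H))
         (subst T (sym (Sym-sound A t t∈ b)) (X⊆A b b∈X)))
  ... | inj₂ b+t∈−H =
    ∈-resp 𝕌.Dir (solve (⊖ᵗ v₀ ⊝ᵗ ⊖ᵗ (v₀ ⊕ᵗ v₁)) v₁ tt (b ∷ t ∷ []) [])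
           (𝕌.⊝∈Dir _ _ b∈−U (proj₂ (A∩−H⊆X∩−U _ b+t∈−H (b+period∈A t t∈))))

  period-of-X : ∀ t → T (Sym X t) → T (𝕌.Dir t)
  period-of-X t t∈ with X⊆U∪−U (b ⊕ t) b+t∈X
    where
    b+t∈X : T (X (b ⊕ t))
    b+t∈X = subst T (Sym-sound X t t∈ (b ⊕ t)) (∈-resp X (solve v₀ (v₀ ⊕ᵗ v₁ ⊝ᵗ v₁) tt (b ∷ t ∷ []) []) b∈X)
  ... | inj₁ b+t∈U = ⊥-elim (X∩[U]=∅ (b ⊝ t) (subst T (sym (Sym-sound X t t∈ b)) b∈X)
         (𝕌.Dir⇒Diff _ (∈-resp 𝕌.Dir (solve (⊖ᵗ v₀ ⊝ᵗ (v₀ ⊕ᵗ v₁)) (v₀ ⊝ᵗ v₁) tt (b ∷ t ∷ []) [])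
                                      (𝕌.⊝∈Dir _ _ b∈−U b+t∈U))))
  ... | inj₂ b+t∈−U =
    ∈-resp 𝕌.Dir (solve (⊖ᵗ v₀ ⊝ᵗ ⊖ᵗ (v₀ ⊕ᵗ v₁)) v₁ tt (b ∷ t ∷ []) []) (𝕌.⊝∈Dir _ _ b∈−U b+t∈−U)

  Sym-A≡Sym-X : ∀ t → Sym A t ≡ Sym X t
  Sym-A≡Sym-X t = T-ext A-period⇒X-period X-period⇒A-period
    where
    A-period⇒X-period : T (Sym A t) → T (Sym X t)
    A-period⇒X-period t∈ = Sym-complete X t λ y →
      ∨-cancelˡ (trans (sym (A≡W∪X (y ⊝ t))) (trans (Sym-sound A t t∈ y) (A≡W∪X y)))
                (W-periodic t (period-of-A t t∈) y) (W∩X=∅ _) (W∩X=∅ y)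
    X-period⇒A-period : T (Sym X t) → T (Sym A t)
    X-period⇒A-period t∈ = Sym-complete A t λ y → begin
      A (y ⊝ t)              ≡⟨ A≡W∪X (y ⊝ t) ⟩
      W (y ⊝ t) ∨ X (y ⊝ t)  ≡⟨ cong₂ _∨_ (W-periodic t (period-of-X t t∈) y) (Sym-sound X t t∈ y) ⟩
      W y ∨ X y              ≡⟨ A≡W∪X y ⟨
      A y                    ∎
      where open ≡-Reasoning

  card-A : card A ≡ card W + card X
  card-A = trans (card-cong A≡W∪X) (countB-∨ W X W∩X=∅ (allV n))

  card-H : card H ≡ card U + (card W + card W)
  card-H = begin
    card H                                                ≡⟨ card-cong (λ x → T-ext (H⇒parts′ x) (parts′⇒H x)) ⟩
    card (λ x → U x ∨ (W x ∨ W (⊖ x ⊝ u₀)))               ≡⟨ countB-∨ U _ U∩parts=∅ (allV n) ⟩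
    card U + card (λ x → W x ∨ W (⊖ x ⊝ u₀))              ≡⟨ cong (card U +_) (countB-∨ W _ W∩−W=∅ (allV n)) ⟩
    card U + (card W + card (λ x → W (⊖ x ⊝ u₀)))         ≡⟨ cong (λ k → card U + (card W + k)) card-−W ⟩
    card U + (card W + card W)                            ∎
    where
    open ≡-Reasoning
    H⇒parts′ : ∀ x → T (H x) → T (U x ∨ (W x ∨ W (⊖ x ⊝ u₀)))
    H⇒parts′ x h∈ with H⇒parts x h∈
    ... | inj₁ u∈          = ∨-introˡ u∈
    ... | inj₂ (inj₁ w∈)   = ∨-introʳ {U x} (∨-introˡ w∈)
    ... | inj₂ (inj₂ neg∈) = ∨-introʳ {U x} (∨-introʳ {W x} (NegSum⇒W x neg∈))
    parts′⇒H : ∀ x → T (U x ∨ (W x ∨ W (⊖ x ⊝ u₀))) → T (H x)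
    parts′⇒H x t with ∨-elim {U x} t
    ... | inj₁ u∈ = parts⇒H x (inj₁ u∈)
    ... | inj₂ t′ with ∨-elim {W x} t′
    ...   | inj₁ w∈ = parts⇒H x (inj₂ (inj₁ w∈))
    ...   | inj₂ w∈ = parts⇒H x (inj₂ (inj₂ (W⇒NegSum x w∈)))
    U∩parts=∅ : ∀ x → T (U x) → ¬ T (W x ∨ W (⊖ x ⊝ u₀))
    U∩parts=∅ x u∈ t with ∨-elim {W x} t
    ... | inj₁ w∈ = U∩W=∅ x u∈ w∈
    ... | inj₂ w∈ = U∩NegSum=∅ x u∈ (W⇒NegSum x w∈)
    W∩−W=∅ : ∀ x → T (W x) → ¬ T (W (⊖ x ⊝ u₀))
    W∩−W=∅ x w∈ w′∈ = W∩NegSum=∅ x w∈ (W⇒NegSum x w′∈)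
    card-−W : card (λ x → W (⊖ x ⊝ u₀)) ≡ card W
    card-−W = trans (card-negate (λ y → W (y ⊝ u₀))) (card-translate W (⊖ u₀))

  card-CU : card CU ≡ 3 * card U
  card-CU = card-layers CU (λ x x∈ → 𝕌.span⇒layers x (proj₁ (CU⇔span x) x∈)) layers⇒CU

  card-identity : CardIdentity CU X → CardIdentity L A
  card-identity X-identity
    rewrite card-A | ℍ.card-L | card-H | card-cong Sym-A≡Sym-X | *-distribʳ-+ 6 (card W) (card X) | X-identity | card-CU =
    rearrange (card W) (card U) (card (Sym X))
    where
    rearrange : ∀ w u s → w * 6 + (3 * u + 3 * s) ≡ 3 * (u + (w + w)) + 3 * s
    rearrange = solve-∀

primitive⇒maximalSumFreeIn : ∀ {n} {L A : Subset n} → Primitive L A → MaximalSumFreeIn L A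
primitive⇒maximalSumFreeIn (hyperplane hyp 𝟎∉A) = HyperplaneCase.maximalSumFreeIn hyp 𝟎∉A
primitive⇒maximalSumFreeIn (compose H U W X CU hyp 𝟎∉H aff U⊆H _ half CU⇔ X-primitive A≡ ii iii iv) =
  Composite.maximalSumFreeIn H U W X CU hyp 𝟎∉H aff U⊆H half CU⇔ A≡ ii iv (MaximalSumFreeIn.A⊆L X-msf) X-msf iii
  where
  X-msf : MaximalSumFreeIn CU X
  X-msf = primitive⇒maximalSumFreeIn X-primitive

primitive⇒cardIdentity : ∀ {n} {L A : Subset n} → Primitive L A → CardIdentity L A
primitive⇒cardIdentity (hyperplane hyp 𝟎∉A) = HyperplaneCase.card-identity hyp 𝟎∉A
primitive⇒cardIdentity (compose H U W X CU hyp 𝟎∉H aff U⊆H _ half CU⇔ X-primitive A≡ ii iii iv) =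
  Composite.card-identity H U W X CU hyp 𝟎∉H aff U⊆H half CU⇔ A≡ ii iv
    (MaximalSumFreeIn.A⊆L (primitive⇒maximalSumFreeIn X-primitive)) (primitive⇒cardIdentity X-primitive)

lemma1p3 : (n : ℕ) (A : Subset n) → Primitive full A →
  MaximalSumFree A × card A * 6 ≡ 3 ^ n + 3 * card (Sym A)
lemma1p3 n A A-primitive =
  maximalSumFree (primitive⇒maximalSumFreeIn A-primitive) ,
  trans (primitive⇒cardIdentity A-primitive) (cong (_+ 3 * card (Sym A)) (card-full n))
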